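{- Let $p,q,n$ be non-negative integers and let $N_{2n+q}$ be the $2^p\times 2^p$ state matrix of $AD_{(p,q;n)}$ (defined in the context). Then $$N_{2n+q}=\prod_{k=1}^n L_{p+2k}\cdot \big(C_{p+2n}\big)^q\cdot \prod_{k=1}^n U_{p+2n+2-2k},$$ where the products are taken in increasing order of $k$ from left to right, i.e. $L_{p+2}L_{p+4}\cdots L_{p+2n}$ and $U_{p+2n}U_{p+2n-2}\cdots U_{p+2}$.
   Context: The region $AD_{(p,q;n)}$: for $j=1,\dots,2n+q$, row $j$ is $[-\ell_j/2,\ell_j/2]\times[j-1,j]$ subdivided into unit squares, with $\ell_j=p+2j$ for $1\le j\le n$, $\ell_j=p+2n$ for $n<j\le n+q$, $\ell_j=p+2(2n+q+1-j)$ for $n+q<j\le 2n+q$; $AD_{(p,q;n)}$ is the union of these rows. Mosaic tiles $T_1,T_2,T_3,T_4$ are unit squares with edges labeled a or b, exactly one edge labeled b: the left edge for $T_1$, top for $T_2$, bottom for $T_3$, right for $T_4$. A mosaic on a region is an assignment of one of these tiles to each unit square; it is suitably adjacent if any two tiles sharing an edge give that edge the same label. For a horizontal row of $m$ tiles, the $b$-state ($t$-state) is the word formed by the labels of its bottom (top) edges read from right to left. Words of length $r$ in $\{\mathrm{a},\mathrm{b}\}$ are ordered lexicographically with $\mathrm{a}<\mathrm{b}$, $\epsilon^r_i$ being the $i$th one. For a bar mosaic, $\mu_{\langle s_r,s_b,s_t\rangle}$ is the number of suitably adjacent rows of tiles with left boundary edge labeled a, right boundary edge labeled $s_r$, $b$-state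 $s_b$, $t$-state $s_t$. Matrices: $C_m$ is the $2^m\times 2^m$ matrix with $(i,j)$-entry $\mu_{\langle \mathrm{a},\epsilon^m_i,\epsilon^m_j\rangle}$ (with $C_0=[1]$ and $C^0$ the identity); for $m\ge 2$, $L_m$ is the $2^{m-2}\times 2^m$ matrix with $(i,j)$-entry $\mu_{\langle \mathrm{a},\mathrm{a}\epsilon^{m-2}_i\mathrm{a},\epsilon^m_j\rangle}$, and $U_m$ is the $2^m\times 2^{m-2}$ matrix with $(i,j)$-entry $\mu_{\langle \mathrm{a},\epsilon^m_i,\mathrm{a}\epsilon^{m-2}_j\mathrm{a}\rangle}$. The state matrix $N_{2n+q}$ is the $2^p\times 2^p$ matrix whose $(i,j)$-entry is the number of suitably adjacent mosaics on $AD_{(p,q;n)}$ such that the bottom edges of the $p$ middle squares of the bottom row, read from right to left, carry the word $\epsilon^p_i$, the top edges of the $p$ middle squares of the top row, read from right to left, carry the word $\epsilon^p_j$, and every other boundary edge of $AD_{(p,q;n)}$ is labeled a. Empty products of matrices are identity matrices. -}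

module Defs where

open import Data.Nat using (ℕ; zero; suc; _+_; _*_; _∸_; _≤ᵇ_; _<ᵇ_; _≡ᵇ_; ⌊_/2⌋)
open import Data.Bool using (Bool; true; false; _∧_; if_then_else_)
open import Data.List as L using (List; []; _∷_; length; filterᵇ; applyUpTo; upTo; concatMap; map; foldr)
open import Data.Vec as V using (Vec; []; _∷_; _∷ʳ_; toList)
open import Data.Maybe using (Maybe; just; nothing)
open import Data.Product using (_×_; _,_)
open import Data.Unit using (⊤; tt)

data Lab : Set where
  a b : Lab

_==_ : Lab → Lab → Bool
a == a = true
b == b = true
_ == _ = false

data Tile : Set where
  T₁ T₂ T₃ T₄ : Tile

leftE topE bottomE rightE : Tile → Lab
leftE T₁ = b
leftE _  = a
topE T₂ = b
topE _  = a
bottomE T₃ = b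
bottomE _  = a
rightE T₄ = b
rightE _  = a

allTiles : List Tile
allTiles = T₁ ∷ T₂ ∷ T₃ ∷ T₄ ∷ []

-- Words.  A word of length r is a Vec Lab r; position 0 is the first
-- letter, i.e. (for states of rows) the label of the RIGHTMOST tile,
-- since states are read from right to left.

Word : ℕ → Set
Word r = Vec Lab r

_==ʷ_ : ∀ {r} → Word r → Word r → Bool
[] ==ʷ [] = true
(x ∷ xs) ==ʷ (y ∷ ys) = (x == y) ∧ (xs ==ʷ ys)

allWords : (r : ℕ) → List (Word r)
allWords zero = [] ∷ []
allWords (suc r) = concatMap (λ x → map (x ∷_) (allWords r)) (a ∷ b ∷ [])

allB : {A : Set} → (A → Bool) → List A → Bool
allB P [] = true
allB P (x ∷ xs) = P x ∧ allB P xs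

count : {A : Set} → (A → Bool) → List A → ℕ
count P xs = length (filterᵇ P xs)

-- Rows of tiles (listed left to right)

allRows : (m : ℕ) → List (Vec Tile m)
allRows zero = [] ∷ []
allRows (suc m) = concatMap (λ t → map (t ∷_) (allRows m)) allTiles

rowOKL : Lab → Lab → List Tile → Bool
rowOKL l r [] = l == r
rowOKL l r (t ∷ ts) = (l == leftE t) ∧ rowOKL (rightE t) r ts

bState tState : ∀ {m} → Vec Tile m → Word m
bState ts = V.reverse (V.map bottomE ts)
tState ts = V.reverse (V.map topE ts)

μ : (m : ℕ) → Lab → Word m → Word m → ℕ
μ m sr sb st =
  count (λ ts → rowOKL a sr (toList ts) ∧ (bState ts ==ʷ sb) ∧ (tState ts ==ʷ st))
        (allRows m)

Mat : ℕ → ℕ → Set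
Mat m k = Word m → Word k → ℕ

sumL : List ℕ → ℕ
sumL = foldr _+_ 0

_⊗_ : ∀ {m k r} → Mat m k → Mat k r → Mat m r
_⊗_ {k = k} A B i j = sumL (map (λ w → A i w * B w j) (allWords k))

Id : ∀ {m} → Mat m m
Id i j = if i ==ʷ j then 1 else 0

_^ᴹ_ : ∀ {m} → Mat m m → ℕ → Mat m m
A ^ᴹ zero = Id
A ^ᴹ suc q = A ⊗ (A ^ᴹ q)

-- dim p k = p + 2k (defined recursively so that indices compute)
dim : ℕ → ℕ → ℕ
dim p zero = p
dim p (suc k) = suc (suc (dim p k))

C : (m : ℕ) → Mat m m
C m i j = μ m a i j

-- L_{k+2} : 2^k × 2^{k+2}
L : (k : ℕ) → Mat k (suc (suc k))
L k i j = μ (suc (suc k)) a (a ∷ (i ∷ʳ a)) j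

-- U_{k+2} : 2^{k+2} × 2^k
U : (k : ℕ) → Mat (suc (suc k)) k
U k i j = μ (suc (suc k)) a i (a ∷ (j ∷ʳ a))

Lprod : (p n : ℕ) → Mat p (dim p n)
Lprod p zero = Id
Lprod p (suc k) = Lprod p k ⊗ L (dim p k)

Uprod : (p n : ℕ) → Mat (dim p n) p
Uprod p zero = Id
Uprod p (suc k) = U (dim p k) ⊗ Uprod p k

-- The region AD_(p,q;n).  Rows j = 1 … 2n+q (bottom to top).
-- Columns are numbered globally 0 … p+2n-1 from the left, column c being
-- the x-interval [c - (p+2n)/2, c+1 - (p+2n)/2].

rowLen : (p q n j : ℕ) → ℕ
rowLen p q n j =
  if j ≤ᵇ n then p + 2 * j
  else if j ≤ᵇ n + q then p + 2 * n
  else p + 2 * (2 * n + q + 1 ∸ j)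

-- row j is [-ℓ_j/2, ℓ_j/2]; its leftmost square is global column (W-ℓ_j)/2
rowOff : (p q n j : ℕ) → ℕ
rowOff p q n j = ⌊ (p + 2 * n ∸ rowLen p q n j) /2⌋

height : (q n : ℕ) → ℕ
height q n = 2 * n + q

rowLens : (p q n : ℕ) → List ℕ
rowLens p q n = applyUpTo (λ i → rowLen p q n (suc i)) (height q n)

Mosaic : List ℕ → Set
Mosaic [] = ⊤
Mosaic (l ∷ ls) = Vec Tile l × Mosaic ls

allMosaics : (ls : List ℕ) → List (Mosaic ls)
allMosaics [] = tt ∷ []
allMosaics (l ∷ ls) = concatMap (λ r → map (r ,_) (allMosaics ls)) (allRows l)

rowsOf : ∀ {ls} → Mosaic ls → List (List Tile)
rowsOf {[]} _ = []
rowsOf {l ∷ ls} (r , m) = toList r ∷ rowsOf m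

nth : {A : Set} → List A → ℕ → Maybe A
nth [] _ = nothing
nth (x ∷ xs) zero = just x
nth (x ∷ xs) (suc i) = nth xs i

module Region (p q n : ℕ) (rs : List (List Tile)) where
  R W : ℕ
  R = height q n
  W = p + 2 * n

  -- tile on the square in row j (1-indexed) and global column c, if any
  sq : ℕ → ℕ → Maybe Tile
  sq zero c = nothing
  sq (suc j') c with nth rs j'
  ... | nothing = nothing
  ... | just row =
    if rowOff p q n (suc j') ≤ᵇ c then nth row (c ∸ rowOff p q n (suc j')) else nothing

  middle : ℕ → Bool
  middle c = (n ≤ᵇ c) ∧ (c <ᵇ n + p)

  letter : Word p → ℕ → Lab
  letter w c with nth (L.reverse (toList w)) (c ∸ n)
  ... | just x = x
  ... | nothing = a

  botOK : Word p → ℕ → ℕ → Tile → Bool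
  botOK wb j c t with sq (j ∸ 1) c
  ... | just t' = bottomE t == topE t'
  ... | nothing = bottomE t == (if (j ≡ᵇ 1) ∧ middle c then letter wb c else a)

  topOK : Word p → ℕ → ℕ → Tile → Bool
  topOK wt j c t with sq (suc j) c
  ... | just _ = true   -- shared edge: checked as the bottom edge of the upper tile
  ... | nothing = topE t == (if (j ≡ᵇ R) ∧ middle c then letter wt c else a)

  vOK : Word p → Word p → ℕ → ℕ → Bool
  vOK wb wt j c with sq j c
  ... | nothing = true
  ... | just t = botOK wb j c t ∧ topOK wt j c t

  good : Word p → Word p → Bool
  good wb wt =
    allB (rowOKL a a) rs ∧
    allB (λ j' → allB (λ c → vOK wb wt (suc j') c) (upTo W)) (upTo R)

countN : (p q n : ℕ) → Mat p p
countN p q n i j =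
  count (λ M → Region.good p q n (rowsOf M) i j) (allMosaics (rowLens p q n))

-- State matrix N_{2n+q} of AD_(p,q;n).  For the empty region
-- (n = q = 0) the convention is the identity matrix.
N : (p q n : ℕ) → Mat p p
N p q n with height q n
... | zero = Id
... | suc _ = countN p q n

module Submission where

open import Algebra.Bundles using (CommutativeMonoid)
open import Data.Bool using (Bool; true; false; _∧_; if_then_else_; T)
open import Data.Bool.Properties using (∧-assoc; ∧-comm; ∧-identityʳ; ∧-zeroʳ; ∧-commutativeMonoid; ⇔→≡; T-≡; if-float)
open import Data.List using (List; []; _∷_; map; concatMap; _++_; applyUpTo; upTo; length; replicate; reverse; initLast; _∷ʳ′_)
import Data.List.Properties as List
open import Data.Maybe using (Maybe; just; nothing)
open import Data.Nat using (ℕ; zero; suc; _+_; _*_; _∸_; _≤_; _<_; z≤n; s≤s; z<s; s<s; _≤ᵇ_; _<ᵇ_; _≡ᵇ_; _≤?_; ⌊_/2⌋; >-nonZero)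
open import Data.Nat.ListAction using (sum)
open import Data.Nat.ListAction.Properties using (sum-++)
open import Data.Nat.Properties
open import Data.Nat.Tactic.RingSolver using (solve-∀)
open import Data.Product using (_,_; proj₁; proj₂)
open import Data.Sum using (inj₁; inj₂)
open import Data.Vec as V using (Vec; []; _∷_; _∷ʳ_; toList)
import Data.Vec.Properties as Vec
open import Function.Bundles using (mk⇔; Equivalence)
open import Relation.Binary.PropositionalEquality
open import Relation.Nullary using (yes; no; contradiction)
open import Algebra.Properties.CommutativeSemigroup +-commutativeSemigroup using () renaming (interchange to +-interchange)
open import Algebra.Properties.CommutativeSemigroup (CommutativeMonoid.commutativeSemigroup ∧-commutativeMonoid) using () renaming (interchange to ∧-interchange)

open import Defs

-- Cut a mosaic of AD_(p,q;n) into its 2n+q rows.  Each row is a bar mosaic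
-- with label a at both ends, and the rows interact only through the horizontal
-- edges: where two rows overlap, the t-state of the lower one must be the
-- b-state of the upper one, and every edge on the boundary carries a, or the
-- prescribed word in the p middle columns.  Each of the first n rows sticks out
-- by one square on both sides of the row below, so it sees the state below
-- flanked by two a's; each of the last n rows leaves the two outermost top
-- edges of the row below it on the boundary.  Summing over the state handed
-- from one row to the next is matrix multiplication, and the three kinds of
-- rows contribute the entries of L, C and U.

private variable
  A B : Set

⟦_⟧ : Bool → ℕ
⟦ β ⟧ = if β then 1 else 0

⟦∧⟧ : ∀ x y → ⟦ x ∧ y ⟧ ≡ ⟦ x ⟧ * ⟦ y ⟧
⟦∧⟧ true y = sym (+-identityʳ ⟦ y ⟧)
⟦∧⟧ false y = refl

∑ : List A → (A → ℕ) → ℕ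
∑ xs f = sumL (map f xs)

∑-cong : (xs : List A) {f g : A → ℕ} → (∀ x → f x ≡ g x) → ∑ xs f ≡ ∑ xs g
∑-cong [] e = refl
∑-cong (x ∷ xs) e = cong₂ _+_ (e x) (∑-cong xs e)

∑-++ : (xs ys : List A) (f : A → ℕ) → ∑ (xs ++ ys) f ≡ ∑ xs f + ∑ ys f
∑-++ xs ys f = trans (cong sum (List.map-++ f xs ys)) (sum-++ (map f xs) _)

∑-0 : (xs : List A) → ∑ xs (λ _ → 0) ≡ 0
∑-0 [] = refl
∑-0 (x ∷ xs) = ∑-0 xs

∑-+ : (xs : List A) (f g : A → ℕ) → ∑ xs (λ x → f x + g x) ≡ ∑ xs f + ∑ xs g
∑-+ [] f g = refl
∑-+ (x ∷ xs) f g = trans (cong (f x + g x +_) (∑-+ xs f g)) (+-interchange (f x) (g x) _ _)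

∑-*ˡ : (c : ℕ) (xs : List A) (f : A → ℕ) → c * ∑ xs f ≡ ∑ xs (λ x → c * f x)
∑-*ˡ c [] f = *-zeroʳ c
∑-*ˡ c (x ∷ xs) f = trans (*-distribˡ-+ c (f x) _) (cong (c * f x +_) (∑-*ˡ c xs f))

∑-*ʳ : (c : ℕ) (xs : List A) (f : A → ℕ) → ∑ xs f * c ≡ ∑ xs (λ x → f x * c)
∑-*ʳ c xs f = trans (*-comm (∑ xs f) c) (trans (∑-*ˡ c xs f) (∑-cong xs (λ x → *-comm c (f x))))

∑-comm : (xs : List A) (ys : List B) (f : A → B → ℕ) →
  ∑ xs (λ x → ∑ ys (f x)) ≡ ∑ ys (λ y → ∑ xs (λ x → f x y))
∑-comm [] ys f = sym (∑-0 ys)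
∑-comm (x ∷ xs) ys f = trans (cong (∑ ys (f x) +_) (∑-comm xs ys f)) (sym (∑-+ ys (f x) _))

∑-map : (h : B → A) (xs : List B) (f : A → ℕ) → ∑ (map h xs) f ≡ ∑ xs (λ x → f (h x))
∑-map h xs f = cong sum (sym (List.map-∘ xs))

∑-concatMap : (g : B → List A) (xs : List B) (f : A → ℕ) →
  ∑ (concatMap g xs) f ≡ ∑ xs (λ x → ∑ (g x) f)
∑-concatMap g [] f = refl
∑-concatMap g (x ∷ xs) f = trans (∑-++ (g x) (concatMap g xs) f) (cong (∑ (g x) f +_) (∑-concatMap g xs f))

count≡∑ : (P : A → Bool) (xs : List A) → count P xs ≡ ∑ xs (λ x → ⟦ P x ⟧)
count≡∑ P [] = refl
count≡∑ P (x ∷ xs) with P x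
... | true = cong suc (count≡∑ P xs)
... | false = count≡∑ P xs

count-cong : {P Q : A → Bool} (xs : List A) → (∀ x → P x ≡ Q x) → count P xs ≡ count Q xs
count-cong {P = P} {Q} xs P≡Q =
  trans (count≡∑ P xs) (trans (∑-cong xs (λ x → cong ⟦_⟧ (P≡Q x))) (sym (count≡∑ Q xs)))

count-∧ : (β : Bool) (P : A → Bool) (xs : List A) → count (λ x → β ∧ P x) xs ≡ ⟦ β ⟧ * count P xs
count-∧ true P xs = sym (+-identityʳ _)
count-∧ false P xs = trans (count≡∑ _ xs) (∑-0 xs)

nthOr : A → List A → ℕ → A
nthOr d [] i = d
nthOr d (x ∷ xs) zero = x
nthOr d (x ∷ xs) (suc i) = nthOr d xs i

nthOr-map : ∀ (f : A → B) (d : A) xs i → nthOr (f d) (map f xs) i ≡ f (nthOr d xs i)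
nthOr-map f d [] i = refl
nthOr-map f d (x ∷ xs) zero = refl
nthOr-map f d (x ∷ xs) (suc i) = nthOr-map f d xs i

nthOr-applyUpTo : ∀ (d : A) (f : ℕ → A) {k i} → i < k → nthOr d (applyUpTo f k) i ≡ f i
nthOr-applyUpTo d f {suc k} {zero} _ = refl
nthOr-applyUpTo d f {suc k} {suc i} (s<s i<k) = nthOr-applyUpTo d (λ i → f (suc i)) i<k

nthOr-replicate : ∀ (d x : A) {k i} → i < k → nthOr d (replicate k x) i ≡ x
nthOr-replicate d x {suc k} {zero} _ = refl
nthOr-replicate d x {suc k} {suc i} (s<s i<k) = nthOr-replicate d x i<k

nthOr-replicate-++ : ∀ (d x : A) k l {i} → i < k → nthOr d (replicate k x ++ l) i ≡ x
nthOr-replicate-++ d x (suc k) l {zero} _ = refl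
nthOr-replicate-++ d x (suc k) l {suc i} (s<s i<k) = nthOr-replicate-++ d x k l i<k

nthOr-replicate-++-+ : ∀ (d x : A) k l i → nthOr d (replicate k x ++ l) (k + i) ≡ nthOr d l i
nthOr-replicate-++-+ d x zero l i = refl
nthOr-replicate-++-+ d x (suc k) l i = nthOr-replicate-++-+ d x k l i

replicate-++-∷ : ∀ k (x : A) l → replicate k x ++ (x ∷ l) ≡ x ∷ (replicate k x ++ l)
replicate-++-∷ zero x l = refl
replicate-++-∷ (suc k) x l = cong (x ∷_) (replicate-++-∷ k x l)

replicate≡applyUpTo : ∀ k (x : A) → replicate k x ≡ applyUpTo (λ _ → x) k
replicate≡applyUpTo zero x = refl
replicate≡applyUpTo (suc k) x = cong (x ∷_) (replicate≡applyUpTo k x)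

applyUpTo-+ : ∀ (f : ℕ → A) k l → applyUpTo f (k + l) ≡ applyUpTo f k ++ applyUpTo (λ i → f (k + i)) l
applyUpTo-+ f zero l = refl
applyUpTo-+ f (suc k) l = cong (f 0 ∷_) (applyUpTo-+ (λ i → f (suc i)) k l)

applyUpTo-cong : ∀ k {f g : ℕ → A} → (∀ i → i < k → f i ≡ g i) → applyUpTo f k ≡ applyUpTo g k
applyUpTo-cong zero f≡g = refl
applyUpTo-cong (suc k) f≡g = cong₂ _∷_ (f≡g 0 z<s) (applyUpTo-cong k (λ i i<k → f≡g (suc i) (s<s i<k)))

nth-just : ∀ (d : A) xs {i} → i < length xs → nth xs i ≡ just (nthOr d xs i)
nth-just d (x ∷ xs) {zero} _ = refl
nth-just d (x ∷ xs) {suc i} (s<s i<n) = nth-just d xs i<n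

nth-nothing : ∀ (xs : List A) {i} → length xs ≤ i → nth xs i ≡ nothing
nth-nothing [] _ = refl
nth-nothing (x ∷ xs) {suc i} (s≤s n≤i) = nth-nothing xs n≤i

allBelow : ℕ → (ℕ → Bool) → Bool
allBelow zero f = true
allBelow (suc k) f = f 0 ∧ allBelow k (λ i → f (suc i))

allBelow-cong : ∀ k {f g : ℕ → Bool} → (∀ i → i < k → f i ≡ g i) → allBelow k f ≡ allBelow k g
allBelow-cong zero f≡g = refl
allBelow-cong (suc k) f≡g = cong₂ _∧_ (f≡g 0 z<s) (allBelow-cong k (λ i i<k → f≡g (suc i) (s<s i<k)))

allBelow-true : ∀ k {f : ℕ → Bool} → (∀ i → i < k → f i ≡ true) → allBelow k f ≡ true
allBelow-true zero f≡true = refl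
allBelow-true (suc k) f≡true rewrite f≡true 0 z<s = allBelow-true k (λ i i<k → f≡true (suc i) (s<s i<k))

allBelow-+ : ∀ k l (f : ℕ → Bool) → allBelow (k + l) f ≡ allBelow k f ∧ allBelow l (λ i → f (k + i))
allBelow-+ zero l f = refl
allBelow-+ (suc k) l f = trans (cong (f 0 ∧_) (allBelow-+ k l (λ i → f (suc i)))) (sym (∧-assoc (f 0) _ _))

allBelow-∧ : ∀ k (f g : ℕ → Bool) → allBelow k (λ i → f i ∧ g i) ≡ allBelow k f ∧ allBelow k g
allBelow-∧ zero f g = refl
allBelow-∧ (suc k) f g =
  trans (cong ((f 0 ∧ g 0) ∧_) (allBelow-∧ k (λ i → f (suc i)) (λ i → g (suc i)))) (∧-interchange (f 0) (g 0) _ _)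

allBelow-last : ∀ k (f : ℕ → Bool) → (∀ i → i < k → f i ≡ true) → allBelow (suc k) f ≡ f k
allBelow-last zero f _ = ∧-identityʳ (f 0)
allBelow-last (suc k) f f≡true rewrite f≡true 0 z<s = allBelow-last k (λ i → f (suc i)) (λ i i<k → f≡true (suc i) (s<s i<k))

allBelow-ends : ∀ k (f : ℕ → Bool) → (∀ i → i < k → f (suc i) ≡ true) → allBelow (suc (suc k)) f ≡ f 0 ∧ f (suc k)
allBelow-ends k f inner≡true = cong (f 0 ∧_) (allBelow-last k (λ i → f (suc i)) inner≡true)

allB-applyUpTo : (f : A → Bool) (g : ℕ → A) (k : ℕ) → allB f (applyUpTo g k) ≡ allBelow k (λ i → f (g i))
allB-applyUpTo f g zero = refl
allB-applyUpTo f g (suc k) = cong (f (g 0) ∧_) (allB-applyUpTo f (λ i → g (suc i)) k)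

≤ᵇ-true : ∀ {m n} → m ≤ n → (m ≤ᵇ n) ≡ true
≤ᵇ-true m≤n = Equivalence.to T-≡ (≤⇒≤ᵇ m≤n)

≤ᵇ-false : ∀ {m n} → n < m → (m ≤ᵇ n) ≡ false
≤ᵇ-false {m} {n} n<m with m ≤ᵇ n in eq
... | false = refl
... | true = contradiction (≤ᵇ⇒≤ m n (Equivalence.from T-≡ eq)) (<⇒≱ n<m)

≡ᵇ-true : ∀ {m n} → m ≡ n → (m ≡ᵇ n) ≡ true
≡ᵇ-true {m} {n} m≡n = Equivalence.to T-≡ (≡⇒≡ᵇ m n m≡n)

≡ᵇ-false : ∀ {m n} → m ≢ n → (m ≡ᵇ n) ≡ false
≡ᵇ-false {m} {n} m≢n with m ≡ᵇ n in eq
... | false = refl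
... | true = contradiction (≡ᵇ⇒≡ m n (Equivalence.from T-≡ eq)) m≢n

∸-pred : ∀ {m k} → k < m → m ∸ k ≡ suc (m ∸ suc k)
∸-pred {m} {k} k<m = trans (sym (suc-pred (m ∸ k) {{>-nonZero (m<n⇒0<n∸m k<m)}})) (cong suc (pred[m∸n]≡m∸[1+n] m k))

half-double : ∀ m → ⌊ 2 * m /2⌋ ≡ m
half-double zero = refl
half-double (suc m) = trans (cong (λ k → ⌊ suc k /2⌋) (+-suc m (m + 0))) (cong suc (half-double m))

2*n+q≡n+q+n : ∀ n q → 2 * n + q ≡ n + q + n
2*n+q≡n+q+n = solve-∀

p+2[1+l]≡2+p+2l : ∀ p l → p + 2 * suc l ≡ suc (suc (p + 2 * l))
p+2[1+l]≡2+p+2l = solve-∀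

p+2[l+d]≡d+[p+2l+d] : ∀ p l d → p + 2 * (l + d) ≡ d + ((p + 2 * l) + d)
p+2[l+d]≡d+[p+2l+d] = solve-∀

d+[p+2l]≡p+[l+d]+l : ∀ p l d → d + (p + 2 * l) ≡ p + (l + d) + l
d+[p+2l]≡p+[l+d]+l = solve-∀

dim≡ : ∀ p k → dim p k ≡ p + 2 * k
dim≡ p zero = sym (+-identityʳ p)
dim≡ p (suc k) = trans (cong (λ m → suc (suc m)) (dim≡ p k)) (sym (p+2[1+l]≡2+p+2l p k))

==-refl : ∀ x → (x == x) ≡ true
==-refl a = refl
==-refl b = refl

==-sound : ∀ x y → (x == y) ≡ true → x ≡ y
==-sound a a _ = refl
==-sound b b _ = refl

∑-δ : ∀ {r} (w₀ : Word r) (g : Word r → ℕ) → ∑ (allWords r) (λ w → ⟦ w₀ ==ʷ w ⟧ * g w) ≡ g w₀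
∑-δ [] g = trans (+-identityʳ _) (+-identityʳ (g []))
∑-δ {suc r} (y ∷ w₀) g = begin
  ∑ (allWords (suc r)) (λ w → ⟦ (y ∷ w₀) ==ʷ w ⟧ * g w)
    ≡⟨ ∑-concatMap (λ x → map (x ∷_) (allWords r)) (a ∷ b ∷ []) _ ⟩
  ∑ (a ∷ b ∷ []) (λ x → ∑ (map (x ∷_) (allWords r)) (λ w → ⟦ (y ∷ w₀) ==ʷ w ⟧ * g w))
    ≡⟨ ∑-cong (a ∷ b ∷ []) (λ x → trans (∑-map (x ∷_) (allWords r) (λ w → ⟦ (y ∷ w₀) ==ʷ w ⟧ * g w)) (first-letter x)) ⟩
  ⟦ y == a ⟧ * g (a ∷ w₀) + (⟦ y == b ⟧ * g (b ∷ w₀) + 0)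
    ≡⟨ pick y ⟩
  g (y ∷ w₀) ∎
  where
  open ≡-Reasoning
  first-letter : ∀ x → ∑ (allWords r) (λ w → ⟦ (y ∷ w₀) ==ʷ (x ∷ w) ⟧ * g (x ∷ w)) ≡ ⟦ y == x ⟧ * g (x ∷ w₀)
  first-letter x = begin
    ∑ (allWords r) (λ w → ⟦ (y == x) ∧ (w₀ ==ʷ w) ⟧ * g (x ∷ w))
      ≡⟨ ∑-cong (allWords r) (λ w → trans (cong (_* g (x ∷ w)) (⟦∧⟧ (y == x) _)) (*-assoc ⟦ y == x ⟧ _ _)) ⟩
    ∑ (allWords r) (λ w → ⟦ y == x ⟧ * (⟦ w₀ ==ʷ w ⟧ * g (x ∷ w)))
      ≡⟨ sym (∑-*ˡ ⟦ y == x ⟧ (allWords r) _) ⟩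
    ⟦ y == x ⟧ * ∑ (allWords r) (λ w → ⟦ w₀ ==ʷ w ⟧ * g (x ∷ w))
      ≡⟨ cong (⟦ y == x ⟧ *_) (∑-δ w₀ (λ w → g (x ∷ w))) ⟩
    ⟦ y == x ⟧ * g (x ∷ w₀) ∎
  pick : ∀ y → ⟦ y == a ⟧ * g (a ∷ w₀) + (⟦ y == b ⟧ * g (b ∷ w₀) + 0) ≡ g (y ∷ w₀)
  pick a = trans (+-identityʳ _) (+-identityʳ _)
  pick b = trans (+-identityʳ _) (+-identityʳ _)

infix 4 _≈ᴹ_
_≈ᴹ_ : ∀ {m k} → Mat m k → Mat m k → Set
A ≈ᴹ B = ∀ i j → A i j ≡ B i j

≈ᴹ-refl : ∀ {m k} {A : Mat m k} → A ≈ᴹ A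
≈ᴹ-refl i j = refl

≈ᴹ-sym : ∀ {m k} {A B : Mat m k} → A ≈ᴹ B → B ≈ᴹ A
≈ᴹ-sym A≈B i j = sym (A≈B i j)

≈ᴹ-trans : ∀ {m k} {A B C′ : Mat m k} → A ≈ᴹ B → B ≈ᴹ C′ → A ≈ᴹ C′
≈ᴹ-trans A≈B B≈C i j = trans (A≈B i j) (B≈C i j)

⊗-cong : ∀ {m k r} {A A′ : Mat m k} {B B′ : Mat k r} → A ≈ᴹ A′ → B ≈ᴹ B′ → A ⊗ B ≈ᴹ A′ ⊗ B′
⊗-cong {k = k} A≈ B≈ i j = ∑-cong (allWords k) (λ w → cong₂ _*_ (A≈ i w) (B≈ w j))

⊗-identityˡ : ∀ {m k} (B : Mat m k) → Id ⊗ B ≈ᴹ B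
⊗-identityˡ B i j = ∑-δ i (λ w → B w j)

⊗-assoc : ∀ {m k r s} (A : Mat m k) (B : Mat k r) (C′ : Mat r s) → (A ⊗ B) ⊗ C′ ≈ᴹ A ⊗ (B ⊗ C′)
⊗-assoc {k = k} {r = r} A B C′ i j = begin
  ∑ (allWords r) (λ w → ∑ (allWords k) (λ v → A i v * B v w) * C′ w j)
    ≡⟨ ∑-cong (allWords r) (λ w → trans (∑-*ʳ (C′ w j) (allWords k) _)
                                        (∑-cong (allWords k) (λ v → *-assoc (A i v) (B v w) (C′ w j)))) ⟩
  ∑ (allWords r) (λ w → ∑ (allWords k) (λ v → A i v * (B v w * C′ w j)))
    ≡⟨ ∑-comm (allWords r) (allWords k) _ ⟩
  ∑ (allWords k) (λ v → ∑ (allWords r) (λ w → A i v * (B v w * C′ w j)))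
    ≡⟨ ∑-cong (allWords k) (λ v → sym (∑-*ˡ (A i v) (allWords r) _)) ⟩
  ∑ (allWords k) (λ v → A i v * ∑ (allWords r) (λ w → B v w * C′ w j)) ∎
  where open ≡-Reasoning

rowOK : ∀ {m} → Vec Tile m → Bool
rowOK r = rowOKL a a (toList r)

endsW : ∀ {d} → Word (suc (suc d)) → Bool
endsW (x ∷ v) = (x == a) ∧ (V.last v == a)

midW : ∀ {d} → Word (suc (suc d)) → Word d
midW (x ∷ v) = V.init v

==ʷ-∷ʳ : ∀ {d} (v w : Word d) x y → ((v ∷ʳ x) ==ʷ (w ∷ʳ y)) ≡ (v ==ʷ w) ∧ (x == y)
==ʷ-∷ʳ [] [] x y = ∧-identityʳ (x == y)
==ʷ-∷ʳ (x′ ∷ v) (y′ ∷ w) x y = trans (cong ((x′ == y′) ∧_) (==ʷ-∷ʳ v w x y)) (sym (∧-assoc (x′ == y′) _ _))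

==ʷ-wrap : ∀ {d} (v : Word (suc (suc d))) (w : Word d) → (v ==ʷ (a ∷ (w ∷ʳ a))) ≡ endsW v ∧ (midW v ==ʷ w)
==ʷ-wrap (x ∷ v) w with V.initLast v
... | m , y , refl = begin
  (x == a) ∧ ((m ∷ʳ y) ==ʷ (w ∷ʳ a))          ≡⟨ cong ((x == a) ∧_) (==ʷ-∷ʳ m w y a) ⟩
  (x == a) ∧ ((m ==ʷ w) ∧ (y == a))           ≡⟨ cong ((x == a) ∧_) (∧-comm (m ==ʷ w) (y == a)) ⟩
  (x == a) ∧ ((y == a) ∧ (m ==ʷ w))           ≡⟨ sym (∧-assoc (x == a) _ _) ⟩
  ((x == a) ∧ (y == a)) ∧ (m ==ʷ w)           ∎
  where open ≡-Reasoning

-- Shapes of stacks of rows, bottom to top, indexed by the lengths of the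
-- states below and above.  A widening row sees the state below it flanked by
-- two a's, as in L; a narrowing row shows the state above it flanked by two
-- a's, as in U.
data Path : ℕ → ℕ → Set where
  []     : ∀ {d} → Path d d
  widen  : ∀ {d e} → Path (suc (suc d)) e → Path d e
  keep   : ∀ {d e} → Path d e → Path d e
  narrow : ∀ {d e} → Path d e → Path (suc (suc d)) e

transfer : ∀ {d e} → Path d e → Mat d e
transfer [] = Id
transfer (widen {d} s) = L d ⊗ transfer s
transfer (keep {d} s) = C d ⊗ transfer s
transfer (narrow {d} s) = U d ⊗ transfer s

rowWidths : ∀ {d e} → Path d e → List ℕ
rowWidths [] = []
rowWidths (widen {d} s) = suc (suc d) ∷ rowWidths s
rowWidths (keep {d} s) = d ∷ rowWidths s
rowWidths (narrow {d} s) = suc (suc d) ∷ rowWidths s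

accepts : ∀ {d e} (s : Path d e) → Word d → Word e → Mosaic (rowWidths s) → Bool
accepts [] x t _ = x ==ʷ t
accepts (widen s) x t (r , M) = (rowOK r ∧ (bState r ==ʷ (a ∷ (x ∷ʳ a)))) ∧ accepts s (tState r) t M
accepts (keep s) x t (r , M) = (rowOK r ∧ (bState r ==ʷ x)) ∧ accepts s (tState r) t M
accepts (narrow s) x t (r , M) = (rowOK r ∧ ((bState r ==ʷ x) ∧ endsW (tState r))) ∧ accepts s (midW (tState r)) t M

count-firstRow : ∀ {m k ls} (cond : Vec Tile m → Bool) (out : Vec Tile m → Word k)
  (rest : Word k → Mosaic ls → Bool) →
  count (λ rM → cond (proj₁ rM) ∧ rest (out (proj₁ rM)) (proj₂ rM)) (allMosaics (m ∷ ls))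
    ≡ ∑ (allWords k) (λ w → count (λ r → cond r ∧ (out r ==ʷ w)) (allRows m) * count (rest w) (allMosaics ls))
count-firstRow {m} {k} {ls} cond out rest = begin
  count _ (allMosaics (m ∷ ls))
    ≡⟨ count≡∑ _ (allMosaics (m ∷ ls)) ⟩
  ∑ (concatMap (λ r → map (r ,_) (allMosaics ls)) (allRows m)) _
    ≡⟨ ∑-concatMap (λ r → map (r ,_) (allMosaics ls)) (allRows m) _ ⟩
  ∑ (allRows m) (λ r → ∑ (map (r ,_) (allMosaics ls)) (λ rM → ⟦ cond (proj₁ rM) ∧ rest (out (proj₁ rM)) (proj₂ rM) ⟧))
    ≡⟨ ∑-cong (allRows m) (λ r → trans (∑-map (r ,_) (allMosaics ls) _)
         (trans (sym (count≡∑ _ (allMosaics ls))) (count-∧ (cond r) (rest (out r)) (allMosaics ls)))) ⟩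
  ∑ (allRows m) (λ r → ⟦ cond r ⟧ * c (out r))
    ≡⟨ ∑-cong (allRows m) (λ r → cong (⟦ cond r ⟧ *_) (sym (∑-δ (out r) c))) ⟩
  ∑ (allRows m) (λ r → ⟦ cond r ⟧ * ∑ (allWords k) (λ w → ⟦ out r ==ʷ w ⟧ * c w))
    ≡⟨ ∑-cong (allRows m) (λ r → ∑-*ˡ ⟦ cond r ⟧ (allWords k) _) ⟩
  ∑ (allRows m) (λ r → ∑ (allWords k) (λ w → ⟦ cond r ⟧ * (⟦ out r ==ʷ w ⟧ * c w)))
    ≡⟨ ∑-comm (allRows m) (allWords k) _ ⟩
  ∑ (allWords k) (λ w → ∑ (allRows m) (λ r → ⟦ cond r ⟧ * (⟦ out r ==ʷ w ⟧ * c w)))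
    ≡⟨ ∑-cong (allWords k) (λ w → begin
         ∑ (allRows m) (λ r → ⟦ cond r ⟧ * (⟦ out r ==ʷ w ⟧ * c w))
           ≡⟨ ∑-cong (allRows m) (λ r → trans (sym (*-assoc ⟦ cond r ⟧ _ (c w))) (cong (_* c w) (sym (⟦∧⟧ (cond r) _)))) ⟩
         ∑ (allRows m) (λ r → ⟦ cond r ∧ (out r ==ʷ w) ⟧ * c w)
           ≡⟨ sym (∑-*ʳ (c w) (allRows m) _) ⟩
         ∑ (allRows m) (λ r → ⟦ cond r ∧ (out r ==ʷ w) ⟧) * c w
           ≡⟨ cong (_* c w) (sym (count≡∑ _ (allRows m))) ⟩
         count (λ r → cond r ∧ (out r ==ʷ w)) (allRows m) * c w ∎) ⟩
  ∑ (allWords k) (λ w → count (λ r → cond r ∧ (out r ==ʷ w)) (allRows m) * c w) ∎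
  where
  open ≡-Reasoning
  c : Word k → ℕ
  c w = count (rest w) (allMosaics ls)

count-accepts : ∀ {d e} (s : Path d e) (x : Word d) (t : Word e) →
  count (accepts s x t) (allMosaics (rowWidths s)) ≡ transfer s x t
count-accepts [] x t with x ==ʷ t
... | true = refl
... | false = refl
count-accepts (widen {d} s) x t = trans
  (count-firstRow (λ r → rowOK r ∧ (bState r ==ʷ (a ∷ (x ∷ʳ a)))) tState (λ w → accepts s w t))
  (∑-cong (allWords (suc (suc d))) (λ w → cong₂ _*_
    (count-cong (allRows (suc (suc d))) (λ r → ∧-assoc (rowOK r) _ _))
    (count-accepts s w t)))
count-accepts (keep {d} s) x t = trans
  (count-firstRow (λ r → rowOK r ∧ (bState r ==ʷ x)) tState (λ w → accepts s w t))
  (∑-cong (allWords d) (λ w → cong₂ _*_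
    (count-cong (allRows d) (λ r → ∧-assoc (rowOK r) _ _))
    (count-accepts s w t)))
count-accepts (narrow {d} s) x t = trans
  (count-firstRow (λ r → rowOK r ∧ ((bState r ==ʷ x) ∧ endsW (tState r))) (λ r → midW (tState r)) (λ w → accepts s w t))
  (∑-cong (allWords d) (λ w → cong₂ _*_
    (count-cong (allRows (suc (suc d))) (λ r → trans (∧-assoc (rowOK r) _ _)
      (cong (rowOK r ∧_) (trans (∧-assoc (bState r ==ʷ x) _ _)
        (cong ((bState r ==ʷ x) ∧_) (sym (==ʷ-wrap (tState r) w)))))))
    (count-accepts s w t)))

-- Reading past the end of a list of labels gives a, the label of every
-- free boundary edge.
infixl 25 _‼_
_‼_ : List Lab → ℕ → Lab
u ‼ i = nthOr a u i

infix 4 _==ᴸ_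
_==ᴸ_ : List Lab → List Lab → Bool
[] ==ᴸ [] = true
(x ∷ u) ==ᴸ (y ∷ v) = (x == y) ∧ (u ==ᴸ v)
_ ==ᴸ _ = false

wrap : List Lab → List Lab
wrap u = a ∷ (u ++ a ∷ [])

dropLast : List Lab → List Lab
dropLast [] = []
dropLast (x ∷ []) = []
dropLast (x ∷ y ∷ u) = x ∷ dropLast (y ∷ u)

inner : List Lab → List Lab
inner [] = []
inner (x ∷ u) = dropLast u

endsA : List Lab → Bool
endsA u = (u ‼ 0 == a) ∧ (u ‼ (length u ∸ 1) == a)

leftToRight : ∀ {d} → Word d → List Lab
leftToRight w = reverse (toList w)

‼-∷ʳa : ∀ u i → (u ++ a ∷ []) ‼ i ≡ u ‼ i
‼-∷ʳa [] zero = refl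
‼-∷ʳa [] (suc i) = refl
‼-∷ʳa (x ∷ u) zero = refl
‼-∷ʳa (x ∷ u) (suc i) = ‼-∷ʳa u i

‼-beyond : ∀ u {i} → length u ≤ i → u ‼ i ≡ a
‼-beyond [] _ = refl
‼-beyond (x ∷ u) {suc i} (s≤s |u|≤i) = ‼-beyond u |u|≤i

‼-∷ʳ-length : ∀ u x → (u ++ x ∷ []) ‼ length u ≡ x
‼-∷ʳ-length [] x = refl
‼-∷ʳ-length (y ∷ u) x = ‼-∷ʳ-length u x

map-‼ : ∀ (f : Tile → Lab) r {i} → i < length r → map f r ‼ i ≡ f (nthOr T₁ r i)
map-‼ f (t ∷ r) {zero} _ = refl
map-‼ f (t ∷ r) {suc i} (s<s i<n) = map-‼ f r i<n

labelOf : Maybe Lab → Lab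
labelOf (just x) = x
labelOf nothing = a

labelOf-nth : ∀ u i → labelOf (nth u i) ≡ u ‼ i
labelOf-nth [] i = refl
labelOf-nth (x ∷ u) zero = refl
labelOf-nth (x ∷ u) (suc i) = labelOf-nth u i

dropLast-∷ʳ : ∀ u x → dropLast (u ++ x ∷ []) ≡ u
dropLast-∷ʳ [] x = refl
dropLast-∷ʳ (y ∷ []) x = refl
dropLast-∷ʳ (y ∷ z ∷ u) x = cong (y ∷_) (dropLast-∷ʳ (z ∷ u) x)

dropLast-‼ : ∀ u {i} → suc i < length u → dropLast u ‼ i ≡ u ‼ i
dropLast-‼ (x ∷ []) {zero} (s<s ())
dropLast-‼ (x ∷ y ∷ u) {zero} _ = refl
dropLast-‼ (x ∷ y ∷ u) {suc i} (s<s i<n) = dropLast-‼ (y ∷ u) i<n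

inner-‼ : ∀ u {i} → suc (suc i) < length u → inner u ‼ i ≡ u ‼ suc i
inner-‼ (x ∷ u) (s<s i<n) = dropLast-‼ u i<n

length-dropLast : ∀ u → length (dropLast u) ≡ length u ∸ 1
length-dropLast [] = refl
length-dropLast (x ∷ []) = refl
length-dropLast (x ∷ y ∷ u) = cong suc (length-dropLast (y ∷ u))

length-inner : ∀ u → length (inner u) ≡ length u ∸ 2
length-inner [] = refl
length-inner (x ∷ u) = length-dropLast u

length-wrap : ∀ u → length (wrap u) ≡ suc (suc (length u))
length-wrap u = cong suc (trans (List.length-++ u) (+-comm (length u) 1))

length-leftToRight : ∀ {d} (w : Word d) → length (leftToRight w) ≡ d
length-leftToRight w = trans (List.length-reverse (toList w)) (Vec.length-toList w)

endsA-∷-∷ʳ : ∀ y u x → endsA (y ∷ (u ++ x ∷ [])) ≡ (y == a) ∧ (x == a)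
endsA-∷-∷ʳ y u x = cong (λ z → (y == a) ∧ (z == a))
  (trans (cong ((y ∷ (u ++ x ∷ [])) ‼_) (trans (List.length-++ u) (+-comm (length u) 1))) (‼-∷ʳ-length u x))

==ᴸ-refl : ∀ u → (u ==ᴸ u) ≡ true
==ᴸ-refl [] = refl
==ᴸ-refl (x ∷ u) rewrite ==-refl x = ==ᴸ-refl u

==ᴸ-sound : ∀ u v → (u ==ᴸ v) ≡ true → u ≡ v
==ᴸ-sound [] [] _ = refl
==ᴸ-sound (x ∷ u) (y ∷ v) eq with x == y in x==y
... | true = cong₂ _∷_ (==-sound x y x==y) (==ᴸ-sound u v eq)

==ᴸ-injective : (f : List Lab → List Lab) → (∀ {u v} → f u ≡ f v → u ≡ v) →
  ∀ u v → (f u ==ᴸ f v) ≡ (u ==ᴸ v)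
==ᴸ-injective f f-inj u v = ⇔→≡ (mk⇔
  (λ eq → subst (λ w → (u ==ᴸ w) ≡ true) (f-inj (==ᴸ-sound (f u) (f v) eq)) (==ᴸ-refl u))
  (λ eq → subst (λ w → (f u ==ᴸ f w) ≡ true) (==ᴸ-sound u v eq) (==ᴸ-refl (f u))))

==ᴸ-allBelow : ∀ u v k → length u ≡ k → length v ≡ k → (u ==ᴸ v) ≡ allBelow k (λ i → u ‼ i == v ‼ i)
==ᴸ-allBelow [] [] zero _ _ = refl
==ᴸ-allBelow (x ∷ u) (y ∷ v) (suc k) |u| |v| =
  cong ((x == y) ∧_) (==ᴸ-allBelow u v k (suc-injective |u|) (suc-injective |v|))

==ᴸ-∷ʳ : ∀ m v y z → ((m ++ y ∷ []) ==ᴸ (v ++ z ∷ [])) ≡ (m ==ᴸ v) ∧ (y == z)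
==ᴸ-∷ʳ [] [] y z = ∧-identityʳ (y == z)
==ᴸ-∷ʳ [] (v₀ ∷ []) y z = ∧-zeroʳ (y == v₀)
==ᴸ-∷ʳ [] (v₀ ∷ v₁ ∷ v) y z = ∧-zeroʳ (y == v₀)
==ᴸ-∷ʳ (m₀ ∷ []) [] y z = ∧-zeroʳ (m₀ == z)
==ᴸ-∷ʳ (m₀ ∷ m₁ ∷ m) [] y z = ∧-zeroʳ (m₀ == z)
==ᴸ-∷ʳ (m₀ ∷ m) (v₀ ∷ v) y z = trans (cong ((m₀ == v₀) ∧_) (==ᴸ-∷ʳ m v y z)) (sym (∧-assoc (m₀ == v₀) _ _))

==ᴸ-wrap : ∀ u v → 2 ≤ length u → (u ==ᴸ wrap v) ≡ endsA u ∧ (inner u ==ᴸ v)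
==ᴸ-wrap (x ∷ u) v (s≤s 1≤|u|) with initLast u
... | [] = contradiction 1≤|u| λ ()
... | m ∷ʳ′ y = begin
  (x == a) ∧ ((m ++ y ∷ []) ==ᴸ (v ++ a ∷ []))   ≡⟨ cong ((x == a) ∧_) (trans (==ᴸ-∷ʳ m v y a) (∧-comm (m ==ᴸ v) (y == a))) ⟩
  (x == a) ∧ ((y == a) ∧ (m ==ᴸ v))              ≡⟨ sym (∧-assoc (x == a) _ _) ⟩
  ((x == a) ∧ (y == a)) ∧ (m ==ᴸ v)              ≡⟨ cong₂ _∧_ (sym (endsA-∷-∷ʳ x m y)) (cong (_==ᴸ v) (sym (dropLast-∷ʳ m y))) ⟩
  endsA (x ∷ (m ++ y ∷ [])) ∧ (inner (x ∷ (m ++ y ∷ [])) ==ᴸ v) ∎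
  where open ≡-Reasoning

allBelow-== : ∀ (f : Tile → Lab) r (g : ℕ → Lab) img k → length r ≡ k → length img ≡ k →
  (∀ i → i < k → g i ≡ img ‼ i) → allBelow k (λ i → f (nthOr T₁ r i) == g i) ≡ (map f r ==ᴸ img)
allBelow-== f r g img k |r| |img| g≡img = sym (trans
  (==ᴸ-allBelow (map f r) img k (trans (List.length-map f r) |r|) |img|)
  (allBelow-cong k (λ i i<k → cong₂ _==_ (map-‼ f r (subst (i <_) (sym |r|) i<k)) (sym (g≡img i i<k)))))

==ʷ-toList : ∀ {d} (u v : Word d) → (u ==ʷ v) ≡ (toList u ==ᴸ toList v)
==ʷ-toList [] [] = refl
==ʷ-toList (x ∷ u) (y ∷ v) = cong ((x == y) ∧_) (==ʷ-toList u v)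

==ʷ-leftToRight : ∀ {d} (u v : Word d) → (u ==ʷ v) ≡ (leftToRight u ==ᴸ leftToRight v)
==ʷ-leftToRight u v = trans (==ʷ-toList u v) (sym (==ᴸ-injective reverse List.reverse-injective (toList u) (toList v)))

leftToRight-state : ∀ {m} (f : Tile → Lab) (r : Vec Tile m) → leftToRight (V.reverse (V.map f r)) ≡ map f (toList r)
leftToRight-state f r =
  trans (cong reverse (Vec.toList-reverse (V.map f r))) (trans (List.reverse-involutive _) (Vec.toList-map f r))

leftToRight-∷-∷ʳ : ∀ {d} x (m : Word d) y → leftToRight (x ∷ (m ∷ʳ y)) ≡ y ∷ (leftToRight m ++ x ∷ [])
leftToRight-∷-∷ʳ x m y = trans (List.unfold-reverse x (toList (m ∷ʳ y)))
  (cong (_++ x ∷ []) (trans (cong reverse (Vec.toList-∷ʳ y m)) (List.reverse-++ (toList m) (y ∷ []))))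

leftToRight-wrap : ∀ {d} (w : Word d) → leftToRight (a ∷ (w ∷ʳ a)) ≡ wrap (leftToRight w)
leftToRight-wrap w = leftToRight-∷-∷ʳ a w a

leftToRight-midW : ∀ {d} (v : Word (suc (suc d))) → leftToRight (midW v) ≡ inner (leftToRight v)
leftToRight-midW (x ∷ v) with V.initLast v
... | m , y , refl = trans (sym (dropLast-∷ʳ (leftToRight m) x)) (cong inner (sym (leftToRight-∷-∷ʳ x m y)))

endsW-leftToRight : ∀ {d} (v : Word (suc (suc d))) → endsW v ≡ endsA (leftToRight v)
endsW-leftToRight (x ∷ v) with V.initLast v
... | m , y , refl = trans (∧-comm (x == a) (y == a))
  (trans (sym (endsA-∷-∷ʳ y (leftToRight m) x)) (cong endsA (sym (leftToRight-∷-∷ʳ x m y))))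

data Kind : Set where
  widening keeping narrowing : Kind

kinds : ∀ {d e} → Path d e → List Kind
kinds [] = []
kinds (widen s) = widening ∷ kinds s
kinds (keep s) = keeping ∷ kinds s
kinds (narrow s) = narrowing ∷ kinds s

bottoms tops : List Tile → List Lab
bottoms = map bottomE
tops = map topE

entry : Kind → List Lab → List Lab
entry widening x = wrap x
entry keeping x = x
entry narrowing x = x

exit : Kind → List Tile → List Lab
exit widening r = tops r
exit keeping r = tops r
exit narrowing r = inner (tops r)

exitOK : Kind → List Tile → Bool
exitOK widening r = true
exitOK keeping r = true
exitOK narrowing r = endsA (tops r)

rowCond : Kind → List Lab → List Tile → Bool
rowCond k x r = (bottoms r ==ᴸ entry k x) ∧ exitOK k r

acceptsL : List Kind → List Lab → List Lab → List (List Tile) → Bool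
acceptsL [] x t [] = x ==ᴸ t
acceptsL (k ∷ ks) x t (r ∷ rs) = (rowOKL a a r ∧ rowCond k x r) ∧ acceptsL ks (exit k r) t rs
acceptsL _ _ _ _ = false

bState-== : ∀ {m} (r : Vec Tile m) (y : Word m) → (bState r ==ʷ y) ≡ (bottoms (toList r) ==ᴸ leftToRight y)
bState-== r y = trans (==ʷ-leftToRight (bState r) y) (cong (_==ᴸ leftToRight y) (leftToRight-state bottomE r))

accepts≡acceptsL : ∀ {d e} (s : Path d e) (x : Word d) (t : Word e) (M : Mosaic (rowWidths s)) →
  accepts s x t M ≡ acceptsL (kinds s) (leftToRight x) (leftToRight t) (rowsOf M)
accepts≡acceptsL [] x t _ = ==ʷ-leftToRight x t
accepts≡acceptsL (widen s) x t (r , M) = cong₂ _∧_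
  (cong (rowOK r ∧_) (trans (bState-== r _) (trans (cong (bottoms (toList r) ==ᴸ_) (leftToRight-wrap x)) (sym (∧-identityʳ _)))))
  (trans (accepts≡acceptsL s (tState r) t M) (cong (λ y → acceptsL (kinds s) y _ (rowsOf M)) (leftToRight-state topE r)))
accepts≡acceptsL (keep s) x t (r , M) = cong₂ _∧_
  (cong (rowOK r ∧_) (trans (bState-== r x) (sym (∧-identityʳ _))))
  (trans (accepts≡acceptsL s (tState r) t M) (cong (λ y → acceptsL (kinds s) y _ (rowsOf M)) (leftToRight-state topE r)))
accepts≡acceptsL (narrow s) x t (r , M) = cong₂ _∧_
  (cong (rowOK r ∧_) (cong₂ _∧_ (bState-== r x) (trans (endsW-leftToRight (tState r)) (cong endsA (leftToRight-state topE r)))))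
  (trans (accepts≡acceptsL s (midW (tState r)) t M)
    (cong (λ y → acceptsL (kinds s) y _ (rowsOf M)) (trans (leftToRight-midW (tState r)) (cong inner (leftToRight-state topE r)))))

incoming : List Kind → List Lab → List (List Tile) → ℕ → List Lab
incoming ks x rs zero = x
incoming ks x rs (suc j) = exit (nthOr keeping ks j) (nthOr [] rs j)

rowSpec : List Kind → List Lab → List Lab → List (List Tile) → ℕ → Bool
rowSpec ks x t rs j =
  rowCond (nthOr keeping ks j) (incoming ks x rs j) (nthOr [] rs j) ∧
  (if suc j ≡ᵇ length ks then incoming ks x rs (suc j) ==ᴸ t else true)

rowSpec-∷ : ∀ k ks x t r rs j → rowSpec (k ∷ ks) x t (r ∷ rs) (suc j) ≡ rowSpec ks (exit k r) t rs j
rowSpec-∷ k ks x t r rs zero = refl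
rowSpec-∷ k ks x t r rs (suc j) = refl

acceptsL-unroll : ∀ ks x t rs → length rs ≡ length ks → 0 < length ks →
  acceptsL ks x t rs ≡ allB (rowOKL a a) rs ∧ allBelow (length ks) (rowSpec ks x t rs)
acceptsL-unroll (k ∷ []) x t (r ∷ []) _ _ = lemma (rowOKL a a r) (rowCond k x r) (exit k r ==ᴸ t)
  where
  lemma : ∀ u v w → (u ∧ v) ∧ w ≡ (u ∧ true) ∧ ((v ∧ w) ∧ true)
  lemma u v w rewrite ∧-identityʳ u | ∧-identityʳ (v ∧ w) = ∧-assoc u v w
acceptsL-unroll (k ∷ k′ ∷ ks) x t (r ∷ r′ ∷ rs) eq _ = begin
  (rowOKL a a r ∧ rowCond k x r) ∧ acceptsL (k′ ∷ ks) (exit k r) t (r′ ∷ rs)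
    ≡⟨ cong ((rowOKL a a r ∧ rowCond k x r) ∧_) (acceptsL-unroll (k′ ∷ ks) (exit k r) t (r′ ∷ rs) (suc-injective eq) z<s) ⟩
  (rowOKL a a r ∧ rowCond k x r) ∧ (allB (rowOKL a a) (r′ ∷ rs) ∧ allBelow (suc (length ks)) (rowSpec (k′ ∷ ks) (exit k r) t (r′ ∷ rs)))
    ≡⟨ ∧-interchange (rowOKL a a r) (rowCond k x r) _ _ ⟩
  (rowOKL a a r ∧ allB (rowOKL a a) (r′ ∷ rs)) ∧ (rowCond k x r ∧ allBelow (suc (length ks)) (rowSpec (k′ ∷ ks) (exit k r) t (r′ ∷ rs)))
    ≡⟨ cong (λ z → (rowOKL a a r ∧ allB (rowOKL a a) (r′ ∷ rs)) ∧ z)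
         (cong₂ _∧_ (sym (∧-identityʳ (rowCond k x r)))
                    (allBelow-cong (suc (length ks)) (λ j _ → sym (rowSpec-∷ k (k′ ∷ ks) x t r (r′ ∷ rs) j)))) ⟩
  allB (rowOKL a a) (r ∷ r′ ∷ rs) ∧ allBelow (suc (suc (length ks))) (rowSpec (k ∷ k′ ∷ ks) x t (r ∷ r′ ∷ rs)) ∎
  where open ≡-Reasoning

widenings : ∀ p k {e} → Path (dim p k) e → Path p e
widenings p zero s = s
widenings p (suc k) s = widenings p k (widen s)

keeps : ∀ {d e} (q : ℕ) → Path d e → Path d e
keeps zero s = s
keeps (suc q) s = keep (keeps q s)

narrowings : ∀ p k → Path (dim p k) p
narrowings p zero = []
narrowings p (suc k) = narrow (narrowings p k)

adPath : ∀ p q n → Path p p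
adPath p q n = widenings p n (keeps q (narrowings p n))

transfer-widenings : ∀ p k {e} (s : Path (dim p k) e) → transfer (widenings p k s) ≈ᴹ Lprod p k ⊗ transfer s
transfer-widenings p zero s = ≈ᴹ-sym (⊗-identityˡ (transfer s))
transfer-widenings p (suc k) s =
  ≈ᴹ-trans (transfer-widenings p k (widen s)) (≈ᴹ-sym (⊗-assoc (Lprod p k) (L (dim p k)) (transfer s)))

transfer-keeps : ∀ {d e} (q : ℕ) (s : Path d e) → transfer (keeps q s) ≈ᴹ (C d ^ᴹ q) ⊗ transfer s
transfer-keeps zero s = ≈ᴹ-sym (⊗-identityˡ (transfer s))
transfer-keeps {d} (suc q) s =
  ≈ᴹ-trans (⊗-cong (≈ᴹ-refl {A = C d}) (transfer-keeps q s)) (≈ᴹ-sym (⊗-assoc (C d) (C d ^ᴹ q) (transfer s)))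

transfer-narrowings : ∀ p k → transfer (narrowings p k) ≈ᴹ Uprod p k
transfer-narrowings p zero = ≈ᴹ-refl
transfer-narrowings p (suc k) = ⊗-cong (≈ᴹ-refl {A = U (dim p k)}) (transfer-narrowings p k)

transfer-adPath : ∀ p q n → transfer (adPath p q n) ≈ᴹ (Lprod p n ⊗ (C (dim p n) ^ᴹ q)) ⊗ Uprod p n
transfer-adPath p q n =
  ≈ᴹ-trans (transfer-widenings p n (keeps q (narrowings p n)))
  (≈ᴹ-trans (⊗-cong (≈ᴹ-refl {A = Lprod p n})
               (≈ᴹ-trans (transfer-keeps q (narrowings p n)) (⊗-cong (≈ᴹ-refl {A = C (dim p n) ^ᴹ q}) (transfer-narrowings p n))))
  (≈ᴹ-sym (⊗-assoc (Lprod p n) (C (dim p n) ^ᴹ q) (Uprod p n))))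

adKinds : ℕ → ℕ → List Kind
adKinds q n = replicate n widening ++ (replicate q keeping ++ replicate n narrowing)

length-adKinds : ∀ q n → length (adKinds q n) ≡ 2 * n + q
length-adKinds q n = begin
  length (adKinds q n)                                      ≡⟨ List.length-++ (replicate n widening) ⟩
  length (replicate n widening) + length (replicate q keeping ++ replicate n narrowing)
    ≡⟨ cong₂ _+_ (List.length-replicate n) (trans (List.length-++ (replicate q keeping))
                                                  (cong₂ _+_ (List.length-replicate q) (List.length-replicate n))) ⟩
  n + (q + n)                                               ≡⟨ sym (trans (2*n+q≡n+q+n n q) (+-assoc n q n)) ⟩
  2 * n + q                                                 ∎
  where open ≡-Reasoning

kinds-adPath : ∀ p q n → kinds (adPath p q n) ≡ adKinds q n
kinds-adPath p q n = trans (kinds-widenings n (keeps q (narrowings p n)))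
  (cong (replicate n widening ++_) (trans (kinds-keeps q (narrowings p n)) (cong (replicate q keeping ++_) (kinds-narrowings n))))
  where
  kinds-widenings : ∀ k {e} (s : Path (dim p k) e) → kinds (widenings p k s) ≡ replicate k widening ++ kinds s
  kinds-widenings zero s = refl
  kinds-widenings (suc k) s = trans (kinds-widenings k (widen s)) (replicate-++-∷ k widening (kinds s))
  kinds-keeps : ∀ {d e} k (s : Path d e) → kinds (keeps k s) ≡ replicate k keeping ++ kinds s
  kinds-keeps zero s = refl
  kinds-keeps (suc k) s = cong (keeping ∷_) (kinds-keeps k s)
  kinds-narrowings : ∀ k → kinds (narrowings p k) ≡ replicate k narrowing
  kinds-narrowings zero = refl
  kinds-narrowings (suc k) = cong (narrowing ∷_) (kinds-narrowings k)

rowWidths-adPath : ∀ p q n → rowWidths (adPath p q n) ≡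
  applyUpTo (λ i → dim p (suc i)) n ++ (replicate q (dim p n) ++ applyUpTo (λ i → dim p (n ∸ i)) n)
rowWidths-adPath p q n = trans (widths-widenings n (keeps q (narrowings p n)))
  (cong (applyUpTo (λ i → dim p (suc i)) n ++_)
    (trans (widths-keeps q (narrowings p n)) (cong (replicate q (dim p n) ++_) (widths-narrowings n))))
  where
  widths-widenings : ∀ k {e} (s : Path (dim p k) e) →
    rowWidths (widenings p k s) ≡ applyUpTo (λ i → dim p (suc i)) k ++ rowWidths s
  widths-widenings zero s = refl
  widths-widenings (suc k) s = trans (widths-widenings k (widen s))
    (trans (sym (List.++-assoc (applyUpTo (λ i → dim p (suc i)) k) (dim p (suc k) ∷ []) (rowWidths s)))
           (cong (_++ rowWidths s) (List.applyUpTo-∷ʳ (λ i → dim p (suc i)) k)))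
  widths-keeps : ∀ {d e} k (s : Path d e) → rowWidths (keeps k s) ≡ replicate k d ++ rowWidths s
  widths-keeps zero s = refl
  widths-keeps {d} (suc k) s = cong (d ∷_) (widths-keeps k s)
  widths-narrowings : ∀ k → rowWidths (narrowings p k) ≡ applyUpTo (λ i → dim p (k ∸ i)) k
  widths-narrowings zero = refl
  widths-narrowings (suc k) = cong (dim p (suc k) ∷_) (widths-narrowings k)

module KindRanges (q n : ℕ) where

  private
    kind : ℕ → Kind
    kind = nthOr keeping (adKinds q n)

  kind-lower : ∀ {j} → j < n → kind j ≡ widening
  kind-lower = nthOr-replicate-++ keeping widening n _

  kind-middle : ∀ {j} → n ≤ j → j < n + q → kind j ≡ keeping
  kind-middle {j} n≤j j<n+q = begin
    kind j                  ≡⟨ cong kind (sym (m+[n∸m]≡n n≤j)) ⟩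
    kind (n + (j ∸ n))      ≡⟨ nthOr-replicate-++-+ keeping widening n _ (j ∸ n) ⟩
    nthOr keeping (replicate q keeping ++ replicate n narrowing) (j ∸ n)
      ≡⟨ nthOr-replicate-++ keeping keeping q _ (+-cancelˡ-< n (j ∸ n) q (subst (_< n + q) (sym (m+[n∸m]≡n n≤j)) j<n+q)) ⟩
    keeping                 ∎
    where open ≡-Reasoning

  kind-upper : ∀ {j} → n + q ≤ j → j < 2 * n + q → kind j ≡ narrowing
  kind-upper {j} n+q≤j j<2n+q = begin
    kind j                            ≡⟨ cong kind (trans (sym (m+[n∸m]≡n n+q≤j)) (+-assoc n q i)) ⟩
    kind (n + (q + i))                ≡⟨ nthOr-replicate-++-+ keeping widening n _ (q + i) ⟩
    nthOr keeping (replicate q keeping ++ replicate n narrowing) (q + i)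
                                      ≡⟨ nthOr-replicate-++-+ keeping keeping q _ i ⟩
    nthOr keeping (replicate n narrowing) i
                                      ≡⟨ nthOr-replicate keeping narrowing i<n ⟩
    narrowing                         ∎
    where
    open ≡-Reasoning
    i = j ∸ (n + q)
    i<n : i < n
    i<n = +-cancelˡ-< (n + q) i n (subst₂ _<_ (sym (m+[n∸m]≡n n+q≤j)) (2*n+q≡n+q+n n q) j<2n+q)

-- Row j of AD_(p,q;n) has length p + 2 level j and starts in column
-- n ∸ level j; level 0 = 0 places the bottom boundary word in the p middle columns.
level : (q n j : ℕ) → ℕ
level q n j = if j ≤ᵇ n then j else if j ≤ᵇ n + q then n else 2 * n + q + 1 ∸ j

module LevelSteps (q n : ℕ) where

  level-lower : ∀ {j} → j ≤ n → level q n j ≡ j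
  level-lower j≤n rewrite ≤ᵇ-true j≤n = refl

  level-middle : ∀ {j} → n ≤ j → j ≤ n + q → level q n j ≡ n
  level-middle {j} n≤j j≤n+q with j ≤ᵇ n in eq
  ... | true = ≤-antisym (≤ᵇ⇒≤ j n (Equivalence.from T-≡ eq)) n≤j
  ... | false rewrite ≤ᵇ-true j≤n+q = refl

  level-upper : ∀ {j} → n + q < j → level q n j ≡ suc (2 * n + q) ∸ j
  level-upper {j} n+q<j rewrite ≤ᵇ-false {j} {n} (≤-<-trans (m≤m+n n q) n+q<j) | ≤ᵇ-false n+q<j =
    cong (_∸ j) (+-comm (2 * n + q) 1)

  level-≤ : ∀ j → level q n j ≤ n
  level-≤ j with j ≤? n
  ... | yes j≤n = subst (_≤ n) (sym (level-lower j≤n)) j≤n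
  ... | no j≰n with j ≤? n + q
  ...   | yes j≤n+q = ≤-reflexive (level-middle (≰⇒≥ j≰n) j≤n+q)
  ...   | no j≰n+q = begin
    level q n j                  ≡⟨ level-upper (≰⇒> j≰n+q) ⟩
    suc (2 * n + q) ∸ j          ≤⟨ ∸-monoʳ-≤ (suc (2 * n + q)) (≰⇒> j≰n+q) ⟩
    suc (2 * n + q) ∸ suc (n + q) ≡⟨ cong (_∸ (n + q)) (2*n+q≡n+q+n n q) ⟩
    (n + q) + n ∸ (n + q)        ≡⟨ m+n∸m≡n (n + q) n ⟩
    n                            ∎
    where open ≤-Reasoning

  level-widen : ∀ {h} → h < n → level q n (suc h) ≡ suc (level q n h)
  level-widen h<n = trans (level-lower h<n) (cong suc (sym (level-lower (<⇒≤ h<n))))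

  level-flat : ∀ {h} → n ≤ h → h ≤ n + q → level q n (suc h) ≡ level q n h
  level-flat {h} n≤h h≤n+q with m≤n⇒m<n∨m≡n h≤n+q
  ... | inj₁ h<n+q = trans (level-middle (m≤n⇒m≤1+n n≤h) h<n+q) (sym (level-middle n≤h h≤n+q))
  ... | inj₂ refl = begin
    level q n (suc (n + q))         ≡⟨ level-upper ≤-refl ⟩
    suc (2 * n + q) ∸ suc (n + q)   ≡⟨ cong (_∸ (n + q)) (2*n+q≡n+q+n n q) ⟩
    (n + q) + n ∸ (n + q)           ≡⟨ m+n∸m≡n (n + q) n ⟩
    n                               ≡⟨ sym (level-middle n≤h ≤-refl) ⟩
    level q n (n + q)               ∎
    where open ≡-Reasoning

  level-narrow : ∀ {h} → n + q < h → h ≤ 2 * n + q → level q n h ≡ suc (level q n (suc h))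
  level-narrow {h} n+q<h h≤2n+q = begin
    level q n h                    ≡⟨ level-upper n+q<h ⟩
    suc (2 * n + q) ∸ h            ≡⟨ +-∸-assoc 1 h≤2n+q ⟩
    suc (2 * n + q ∸ h)            ≡⟨ cong suc (sym (level-upper (m<n⇒m<1+n n+q<h))) ⟩
    suc (level q n (suc h))        ∎
    where open ≡-Reasoning

  level-nondecreasing : ∀ {h} → h ≤ n + q → level q n h ≤ level q n (suc h)
  level-nondecreasing {h} h≤n+q with h <? n
  ... | yes h<n = ≤-trans (n≤1+n _) (≤-reflexive (sym (level-widen h<n)))
  ... | no h≮n = ≤-reflexive (sym (level-flat (≮⇒≥ h≮n) h≤n+q))

rowLen-level : ∀ p q n j → rowLen p q n j ≡ p + 2 * level q n j
rowLen-level p q n j =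
  trans (cong (if j ≤ᵇ n then p + 2 * j else_) (sym (if-float (λ l → p + 2 * l) (j ≤ᵇ n + q))))
        (sym (if-float (λ l → p + 2 * l) (j ≤ᵇ n)))

rowOff-level : ∀ p q n j → rowOff p q n j ≡ n ∸ level q n j
rowOff-level p q n j = begin
  ⌊ (p + 2 * n ∸ rowLen p q n j) /2⌋          ≡⟨ cong (λ l → ⌊ (p + 2 * n ∸ l) /2⌋) (rowLen-level p q n j) ⟩
  ⌊ (p + 2 * n ∸ (p + 2 * level q n j)) /2⌋   ≡⟨ cong ⌊_/2⌋ ([m+n]∸[m+o]≡n∸o p (2 * n) (2 * level q n j)) ⟩
  ⌊ (2 * n ∸ 2 * level q n j) /2⌋             ≡⟨ cong ⌊_/2⌋ (sym (*-distribˡ-∸ 2 n (level q n j))) ⟩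
  ⌊ 2 * (n ∸ level q n j) /2⌋                 ≡⟨ half-double _ ⟩
  n ∸ level q n j                             ∎
  where open ≡-Reasoning

rowLens≡rowWidths : ∀ p q n → rowLens p q n ≡ rowWidths (adPath p q n)
rowLens≡rowWidths p q n = begin
  applyUpTo width (2 * n + q)
    ≡⟨ cong (applyUpTo width) (trans (2*n+q≡n+q+n n q) (+-assoc n q n)) ⟩
  applyUpTo width (n + (q + n))
    ≡⟨ trans (applyUpTo-+ width n (q + n)) (cong (applyUpTo width n ++_) (applyUpTo-+ (λ i → width (n + i)) q n)) ⟩
  applyUpTo width n ++ (applyUpTo (λ i → width (n + i)) q ++ applyUpTo (λ i → width (n + (q + i))) n)
    ≡⟨ cong₂ _++_ (applyUpTo-cong n lower)
         (cong₂ _++_ (trans (applyUpTo-cong q middle) (sym (replicate≡applyUpTo q (dim p n)))) (applyUpTo-cong n upper)) ⟩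
  applyUpTo (λ i → dim p (suc i)) n ++ (replicate q (dim p n) ++ applyUpTo (λ i → dim p (n ∸ i)) n)
    ≡⟨ sym (rowWidths-adPath p q n) ⟩
  rowWidths (adPath p q n) ∎
  where
  open ≡-Reasoning
  open LevelSteps q n
  width : ℕ → ℕ
  width i = rowLen p q n (suc i)
  width≡dim : ∀ j → rowLen p q n j ≡ dim p (level q n j)
  width≡dim j = trans (rowLen-level p q n j) (sym (dim≡ p (level q n j)))
  lower : ∀ i → i < n → width i ≡ dim p (suc i)
  lower i i<n = trans (width≡dim (suc i)) (cong (dim p) (level-lower i<n))
  middle : ∀ i → i < q → width (n + i) ≡ dim p n
  middle i i<q = trans (width≡dim (suc (n + i)))
    (cong (dim p) (level-middle (≤-trans (m≤m+n n i) (n≤1+n _)) (subst (_≤ n + q) (+-suc n i) (+-monoʳ-≤ n i<q))))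
  upper : ∀ i → i < n → width (n + (q + i)) ≡ dim p (n ∸ i)
  upper i i<n = trans (width≡dim (suc (n + (q + i)))) (cong (dim p) (begin
    level q n (suc (n + (q + i)))       ≡⟨ level-upper (s≤s (subst (n + q ≤_) (+-assoc n q i) (m≤m+n (n + q) i))) ⟩
    2 * n + q ∸ (n + (q + i))           ≡⟨ cong₂ _∸_ (2*n+q≡n+q+n n q) (sym (+-assoc n q i)) ⟩
    n + q + n ∸ (n + q + i)             ≡⟨ [m+n]∸[m+o]≡n∸o (n + q) n i ⟩
    n ∸ i                               ∎))

map-length-rowsOf : ∀ ls (M : Mosaic ls) → map length (rowsOf M) ≡ ls
map-length-rowsOf [] _ = refl
map-length-rowsOf (l ∷ ls) (r , M) = cong₂ _∷_ (Vec.length-toList r) (map-length-rowsOf ls M)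

layerLabel : List Lab → ℕ → ℕ → Lab
layerLabel u o c = if o ≤ᵇ c then u ‼ (c ∸ o) else a

layerLabel-before : ∀ u {o c} → c < o → layerLabel u o c ≡ a
layerLabel-before u c<o rewrite ≤ᵇ-false c<o = refl

layerLabel-shift : ∀ u o i → layerLabel u o (o + i) ≡ u ‼ i
layerLabel-shift u o i rewrite ≤ᵇ-true (m≤m+n o i) | m+n∸m≡n o i = refl

layerLabel-wrap : ∀ u o i → layerLabel u (suc o) (o + i) ≡ wrap u ‼ i
layerLabel-wrap u o zero = layerLabel-before u (s≤s (≤-reflexive (+-identityʳ o)))
layerLabel-wrap u o (suc i) =
  trans (cong (layerLabel u (suc o)) (+-suc o i)) (trans (layerLabel-shift u (suc o) i) (sym (‼-∷ʳa u i)))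

layerLabel-inner : ∀ u o {i} → suc (suc i) < length u → layerLabel u o (suc o + i) ≡ inner u ‼ i
layerLabel-inner u o {i} i<n =
  trans (cong (layerLabel u o) (sym (+-suc o i))) (trans (layerLabel-shift u o (suc i)) (sym (inner-‼ u i<n)))

tileAt : List Tile → ℕ → ℕ → Maybe Tile
tileAt r o c = if o ≤ᵇ c then nth r (c ∸ o) else nothing

tileAt-before : ∀ r {o c} → c < o → tileAt r o c ≡ nothing
tileAt-before r c<o rewrite ≤ᵇ-false c<o = refl

tileAt-shift : ∀ r o i → tileAt r o (o + i) ≡ nth r i
tileAt-shift r o i rewrite ≤ᵇ-true (m≤m+n o i) | m+n∸m≡n o i = refl

tileAt-inside : ∀ r {o c} → o ≤ c → c < o + length r → tileAt r o c ≡ just (nthOr T₁ r (c ∸ o))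
tileAt-inside r {o} {c} o≤c c<o+|r| rewrite ≤ᵇ-true o≤c =
  nth-just T₁ r (+-cancelˡ-< o (c ∸ o) (length r) (subst (_< o + length r) (sym (m+[n∸m]≡n o≤c)) c<o+|r|))

topLabel : Maybe Tile → Lab
topLabel (just t) = topE t
topLabel nothing = a

topLabel-nth : ∀ r i → topLabel (nth r i) ≡ tops r ‼ i
topLabel-nth [] i = refl
topLabel-nth (t ∷ r) zero = refl
topLabel-nth (t ∷ r) (suc i) = topLabel-nth r i

topLabel-tileAt : ∀ r o c → topLabel (tileAt r o c) ≡ layerLabel (tops r) o c
topLabel-tileAt r o c with o ≤ᵇ c
... | true = topLabel-nth r (c ∸ o)
... | false = refl

module RowChecks (p q n : ℕ) (rs : List (List Tile)) (wb wt : Word p)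
  (rows-length : length rs ≡ 2 * n + q)
  (row-length : ∀ {j} → j < 2 * n + q → length (nthOr [] rs j) ≡ p + 2 * level q n (suc j)) where

  open Region p q n rs
  open LevelSteps q n
  open KindRanges q n

  -- rs is 0-indexed and the region's rows are 1-indexed, so row j is row suc j
  -- of the region; lev, off, wid and layer are indexed like the region, and
  -- layer 0, the top side of row 0, is the bottom boundary.
  lev off wid : ℕ → ℕ
  lev = level q n
  off j = n ∸ lev j
  wid j = p + 2 * lev j

  row : ℕ → List Tile
  row = nthOr [] rs

  tile : ℕ → ℕ → Tile
  tile j = nthOr T₁ (row j)

  layer : ℕ → List Lab
  layer zero = leftToRight wb
  layer (suc j) = tops (row j)

  kind : ℕ → Kind
  kind = nthOr keeping (adKinds q n)

  entering : ℕ → List Lab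
  entering = incoming (adKinds q n) (leftToRight wb) rs

  bottomCheck topCheck : ℕ → Bool
  bottomCheck j = allBelow (wid (suc j)) (λ i → botOK wb (suc j) (off (suc j) + i) (tile j i))
  topCheck j = allBelow (wid (suc j)) (λ i → topOK wt (suc j) (off (suc j) + i) (tile j i))

  layer-length : ∀ {j} → j ≤ R → length (layer j) ≡ wid j
  layer-length {zero} _ = trans (length-leftToRight wb) (sym (+-identityʳ p))
  layer-length {suc j} j<R = trans (List.length-map topE (row j)) (row-length j<R)

  nth-row : ∀ {j} → j < R → nth rs j ≡ just (row j)
  nth-row j<R = nth-just [] rs (subst (_ <_) (sym rows-length) j<R)

  sq-row : ∀ {j} c → j < R → sq (suc j) c ≡ tileAt (row j) (off (suc j)) c
  sq-row {j} c j<R rewrite nth-row j<R | rowOff-level p q n (suc j) = refl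

  sq-beyond : ∀ {j} c → R ≤ j → sq (suc j) c ≡ nothing
  sq-beyond {j} c R≤j rewrite nth-nothing rs (subst (_≤ j) (sym rows-length) R≤j) = refl

  letter-‼ : ∀ w c → letter w c ≡ leftToRight w ‼ (c ∸ n)
  letter-‼ w c with nth (reverse (toList w)) (c ∸ n) | labelOf-nth (leftToRight w) (c ∸ n)
  ... | just x | eq = eq
  ... | nothing | eq = eq

  boundary-label : ∀ w c → (if middle c then letter w c else a) ≡ layerLabel (leftToRight w) n c
  boundary-label w c with n ≤ᵇ c in n≤ᵇc
  ... | false = refl
  ... | true with c <ᵇ n + p in c<ᵇn+p
  ...   | true = letter-‼ w c
  ...   | false = sym (‼-beyond (leftToRight w) (begin
    length (leftToRight w)  ≡⟨ length-leftToRight w ⟩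
    p                       ≤⟨ +-cancelˡ-≤ n p (c ∸ n) (begin
      n + p                   ≤⟨ ≮⇒≥ (λ c<n+p → subst T c<ᵇn+p (<⇒<ᵇ c<n+p)) ⟩
      c                       ≡⟨ sym (m+[n∸m]≡n (≤ᵇ⇒≤ n c (Equivalence.from T-≡ n≤ᵇc))) ⟩
      n + (c ∸ n)             ∎) ⟩
    c ∸ n                   ∎))
    where open ≤-Reasoning

  botOK-upper : ∀ j c t → botOK wb (suc (suc j)) c t ≡ (bottomE t == topLabel (sq (suc j) c))
  botOK-upper j c t with sq (suc j) c
  ... | just t′ = refl
  ... | nothing = refl

  botOK-below : ∀ {j} c t → j < R → botOK wb (suc j) c t ≡ (bottomE t == layerLabel (layer j) (off j) c)
  botOK-below {zero} c t _ = cong (bottomE t ==_) (boundary-label wb c)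
  botOK-below {suc j} c t sj<R = trans (botOK-upper j c t)
    (cong (bottomE t ==_) (trans (cong topLabel (sq-row c (<-trans (n<1+n j) sj<R))) (topLabel-tileAt (row j) (off (suc j)) c)))

  vOK-free : ∀ j c → sq j c ≡ nothing → vOK wb wt j c ≡ true
  vOK-free j c sq≡ rewrite sq≡ = refl

  vOK-tile : ∀ j c t → sq j c ≡ just t → vOK wb wt j c ≡ botOK wb j c t ∧ topOK wt j c t
  vOK-tile j c t sq≡ rewrite sq≡ = refl

  row-split : ∀ {j} → j < R → allBelow W (vOK wb wt (suc j)) ≡ bottomCheck j ∧ topCheck j
  row-split {j} j<R = begin
    allBelow W f
      ≡⟨ cong (λ k → allBelow k f) W≡ ⟩
    allBelow (o + (w + o)) f
      ≡⟨ trans (allBelow-+ o (w + o) f) (cong (allBelow o f ∧_) (allBelow-+ w o (λ i → f (o + i)))) ⟩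
    allBelow o f ∧ (allBelow w (λ i → f (o + i)) ∧ allBelow o (λ i → f (o + (w + i))))
      ≡⟨ cong₂ (λ x y → x ∧ (y ∧ allBelow o (λ i → f (o + (w + i))))) left-margin (allBelow-cong w on-row) ⟩
    allBelow w (λ i → bot i ∧ top i) ∧ allBelow o (λ i → f (o + (w + i)))
      ≡⟨ trans (cong (allBelow w (λ i → bot i ∧ top i) ∧_) right-margin) (∧-identityʳ _) ⟩
    allBelow w (λ i → bot i ∧ top i)
      ≡⟨ allBelow-∧ w bot top ⟩
    bottomCheck j ∧ topCheck j ∎
    where
    open ≡-Reasoning
    f = vOK wb wt (suc j)
    o = off (suc j)
    w = wid (suc j)
    bot top : ℕ → Bool
    bot i = botOK wb (suc j) (o + i) (tile j i)
    top i = topOK wt (suc j) (o + i) (tile j i)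
    |row| : length (row j) ≡ w
    |row| = row-length j<R
    W≡ : p + 2 * n ≡ o + (w + o)
    W≡ = trans (cong (λ m → p + 2 * m) (sym (m+[n∸m]≡n (level-≤ (suc j))))) (p+2[l+d]≡d+[p+2l+d] p (lev (suc j)) o)
    left-margin : allBelow o f ≡ true
    left-margin = allBelow-true o (λ c c<o → vOK-free (suc j) c (trans (sq-row c j<R) (tileAt-before (row j) c<o)))
    on-row : ∀ i → i < w → f (o + i) ≡ bot i ∧ top i
    on-row i i<w = vOK-tile (suc j) (o + i) (tile j i)
      (trans (sq-row (o + i) j<R) (trans (tileAt-shift (row j) o i) (nth-just T₁ (row j) (subst (i <_) (sym |row|) i<w))))
    right-margin : allBelow o (λ i → f (o + (w + i))) ≡ true
    right-margin = allBelow-true o (λ i _ → vOK-free (suc j) (o + (w + i))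
      (trans (sq-row (o + (w + i)) j<R) (trans (tileAt-shift (row j) o (w + i)) (nth-nothing (row j) (subst (_≤ w + i) (sym |row|) (m≤m+n w i))))))

  bottomCheck-layer : ∀ {j} → j < R →
    bottomCheck j ≡ allBelow (wid (suc j)) (λ i → bottomE (tile j i) == layerLabel (layer j) (off j) (off (suc j) + i))
  bottomCheck-layer {j} j<R = allBelow-cong (wid (suc j)) (λ i _ → botOK-below (off (suc j) + i) (tile j i) j<R)

  bottomCheck-widen : ∀ {j} → j < R → lev (suc j) ≡ suc (lev j) → bottomCheck j ≡ (bottoms (row j) ==ᴸ wrap (layer j))
  bottomCheck-widen {j} j<R up = trans (bottomCheck-layer j<R)
    (allBelow-== bottomE (row j) _ (wrap (layer j)) (wid (suc j)) (row-length j<R) |wrap| pointwise)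
    where
    off≡ : off j ≡ suc (off (suc j))
    off≡ = trans (∸-pred (subst (_≤ n) up (level-≤ (suc j)))) (cong (λ l → suc (n ∸ l)) (sym up))
    |wrap| : length (wrap (layer j)) ≡ wid (suc j)
    |wrap| = trans (length-wrap (layer j)) (trans (cong (λ m → suc (suc m)) (layer-length (<⇒≤ j<R)))
      (sym (trans (cong (λ l → p + 2 * l) up) (p+2[1+l]≡2+p+2l p (lev j)))))
    pointwise : ∀ i → i < wid (suc j) → layerLabel (layer j) (off j) (off (suc j) + i) ≡ wrap (layer j) ‼ i
    pointwise i _ = trans (cong (λ o → layerLabel (layer j) o (off (suc j) + i)) off≡) (layerLabel-wrap (layer j) (off (suc j)) i)

  bottomCheck-flat : ∀ {j} → j < R → lev (suc j) ≡ lev j → bottomCheck j ≡ (bottoms (row j) ==ᴸ layer j)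
  bottomCheck-flat {j} j<R same = trans (bottomCheck-layer j<R)
    (allBelow-== bottomE (row j) _ (layer j) (wid (suc j)) (row-length j<R)
      (trans (layer-length (<⇒≤ j<R)) (cong (λ l → p + 2 * l) (sym same))) pointwise)
    where
    pointwise : ∀ i → i < wid (suc j) → layerLabel (layer j) (off j) (off (suc j) + i) ≡ layer j ‼ i
    pointwise i _ = trans (cong (λ l → layerLabel (layer j) (n ∸ l) (off (suc j) + i)) (sym same))
      (layerLabel-shift (layer j) (off (suc j)) i)

  bottomCheck-narrow : ∀ {j} → j < R → lev j ≡ suc (lev (suc j)) → bottomCheck j ≡ (bottoms (row j) ==ᴸ inner (layer j))
  bottomCheck-narrow {j} j<R down = trans (bottomCheck-layer j<R)
    (allBelow-== bottomE (row j) _ (inner (layer j)) (wid (suc j)) (row-length j<R) |inner| pointwise)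
    where
    off≡ : off (suc j) ≡ suc (off j)
    off≡ = trans (∸-pred (subst (_≤ n) down (level-≤ j))) (cong (λ l → suc (n ∸ l)) (sym down))
    |layer| : length (layer j) ≡ suc (suc (wid (suc j)))
    |layer| = trans (layer-length (≤-trans (n≤1+n j) j<R)) (trans (cong (λ l → p + 2 * l) down) (p+2[1+l]≡2+p+2l p (lev (suc j))))
    |inner| : length (inner (layer j)) ≡ wid (suc j)
    |inner| = trans (length-inner (layer j)) (cong (_∸ 2) |layer|)
    pointwise : ∀ i → i < wid (suc j) → layerLabel (layer j) (off j) (off (suc j) + i) ≡ inner (layer j) ‼ i
    pointwise i i<w = trans (cong (λ o → layerLabel (layer j) (off j) (o + i)) off≡)
      (layerLabel-inner (layer j) (off j) (subst (suc (suc i) <_) (sym |layer|) (s<s (s<s i<w))))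

  entering-layer : ∀ {j} → j ≤ n + q → entering j ≡ layer j
  entering-layer {zero} _ = refl
  entering-layer {suc j} sj≤n+q with j <? n
  ... | yes j<n = cong (λ k → exit k (row j)) (kind-lower j<n)
  ... | no j≮n = cong (λ k → exit k (row j)) (kind-middle (≮⇒≥ j≮n) sj≤n+q)

  entering-inner : ∀ {j} → n + q < j → j ≤ R → entering j ≡ inner (layer j)
  entering-inner {suc j} n+q<sj sj≤R = cong (λ k → exit k (row j)) (kind-upper (≤-pred n+q<sj) sj≤R)

  entry-beyond-widening : ∀ {j} x → n ≤ j → j < R → entry (kind j) x ≡ x
  entry-beyond-widening {j} x n≤j j<R with j <? n + q
  ... | yes j<n+q = cong (λ k → entry k x) (kind-middle n≤j j<n+q)
  ... | no j≮n+q = cong (λ k → entry k x) (kind-upper (≮⇒≥ j≮n+q) j<R)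

  bottomCheck≡entry : ∀ {j} → j < R → bottomCheck j ≡ (bottoms (row j) ==ᴸ entry (kind j) (entering j))
  bottomCheck≡entry {j} j<R with j <? n
  ... | yes j<n = trans (bottomCheck-widen j<R (level-widen j<n))
    (cong₂ (λ k x → bottoms (row j) ==ᴸ entry k x) (sym (kind-lower j<n))
      (sym (entering-layer (≤-trans (<⇒≤ j<n) (m≤m+n n q)))))
  ... | no j≮n with j ≤? n + q
  ...   | yes j≤n+q = trans (bottomCheck-flat j<R (level-flat (≮⇒≥ j≮n) j≤n+q))
    (cong (bottoms (row j) ==ᴸ_) (sym (trans (entry-beyond-widening (entering j) (≮⇒≥ j≮n) j<R) (entering-layer j≤n+q))))
  ...   | no j≰n+q = trans (bottomCheck-narrow j<R (level-narrow (≰⇒> j≰n+q) (<⇒≤ j<R)))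
    (cong (bottoms (row j) ==ᴸ_) (sym (trans (entry-beyond-widening (entering j) (≤-trans (m≤m+n n q) (<⇒≤ (≰⇒> j≰n+q))) j<R)
                                             (entering-inner (≰⇒> j≰n+q) (<⇒≤ j<R)))))

  off+wid : ∀ j → off j + wid j ≡ p + n + lev j
  off+wid j = trans (d+[p+2l]≡p+[l+d]+l p (lev j) (off j)) (cong (λ m → p + m + lev j) (m+[n∸m]≡n (level-≤ j)))

  topOK-covered : ∀ j c t t′ → sq (suc (suc j)) c ≡ just t′ → topOK wt (suc j) c t ≡ true
  topOK-covered j c t t′ sq≡ rewrite sq≡ = refl

  topOK-open : ∀ j c t → sq (suc (suc j)) c ≡ nothing →
    topOK wt (suc j) c t ≡ (topE t == (if (suc j ≡ᵇ R) ∧ middle c then letter wt c else a))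
  topOK-open j c t sq≡ rewrite sq≡ = refl

  topOK-inner : ∀ {j} c t → suc j < R → sq (suc (suc j)) c ≡ nothing → topOK wt (suc j) c t ≡ (topE t == a)
  topOK-inner {j} c t sj<R sq≡ rewrite topOK-open j c t sq≡ | ≡ᵇ-false (<⇒≢ sj<R) = refl

  topOK-last : ∀ {j} c t → suc j ≡ R → topOK wt (suc j) c t ≡ (topE t == layerLabel (leftToRight wt) n c)
  topOK-last {j} c t sj≡R rewrite topOK-open j c t (sq-beyond c (≤-reflexive (sym sj≡R))) | ≡ᵇ-true sj≡R =
    cong (topE t ==_) (boundary-label wt c)

  topCheck-covered : ∀ {j} → suc j < R → lev (suc j) ≤ lev (suc (suc j)) → topCheck j ≡ true
  topCheck-covered {j} sj<R lev≤ = allBelow-true (wid (suc j)) λ i i<w →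
    topOK-covered j (o + i) (tile j i) _ (trans (sq-row (o + i) sj<R) (tileAt-inside (row (suc j))
      (≤-trans (∸-monoʳ-≤ n lev≤) (m≤m+n o i))
      (begin-strict
        o + i                              <⟨ +-monoʳ-< o i<w ⟩
        o + wid (suc j)                    ≡⟨ off+wid (suc j) ⟩
        p + n + lev (suc j)                ≤⟨ +-monoʳ-≤ (p + n) lev≤ ⟩
        p + n + lev (suc (suc j))          ≡⟨ sym (off+wid (suc (suc j))) ⟩
        off (suc (suc j)) + wid (suc (suc j)) ≡⟨ cong (off (suc (suc j)) +_) (sym (row-length sj<R)) ⟩
        off (suc (suc j)) + length (row (suc j)) ∎)))
    where
    open ≤-Reasoning
    o = off (suc j)

  topCheck-ends : ∀ {j} → suc j < R → lev (suc j) ≡ suc (lev (suc (suc j))) → topCheck j ≡ endsA (tops (row j))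
  topCheck-ends {j} sj<R down = begin
    allBelow (wid (suc j)) f                  ≡⟨ cong (λ k → allBelow k f) w≡ ⟩
    allBelow (suc (suc w′)) f                 ≡⟨ allBelow-ends w′ f covered ⟩
    f 0 ∧ f (suc w′)                          ≡⟨ cong₂ _∧_ first last ⟩
    (tops (row j) ‼ 0 == a) ∧ (tops (row j) ‼ suc w′ == a)
      ≡⟨ cong (λ k → (tops (row j) ‼ 0 == a) ∧ (tops (row j) ‼ k == a))
              (sym (cong (_∸ 1) (trans (List.length-map topE (row j)) |row|))) ⟩
    endsA (tops (row j))                      ∎
    where
    open ≡-Reasoning
    o = off (suc j)
    w′ = wid (suc (suc j))
    f : ℕ → Bool
    f i = topOK wt (suc j) (o + i) (tile j i)
    w≡ : wid (suc j) ≡ suc (suc w′)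
    w≡ = trans (cong (λ l → p + 2 * l) down) (p+2[1+l]≡2+p+2l p (lev (suc (suc j))))
    |row| : length (row j) ≡ suc (suc w′)
    |row| = trans (row-length (<-trans (n<1+n j) sj<R)) w≡
    |next| : length (row (suc j)) ≡ w′
    |next| = row-length sj<R
    off≡ : off (suc (suc j)) ≡ suc o
    off≡ = trans (∸-pred (subst (_≤ n) down (level-≤ (suc j)))) (cong (λ l → suc (n ∸ l)) (sym down))
    above : ∀ i → sq (suc (suc j)) (o + suc i) ≡ nth (row (suc j)) i
    above i = trans (sq-row (o + suc i) sj<R)
      (trans (cong (tileAt (row (suc j)) (off (suc (suc j)))) (trans (+-suc o i) (cong (_+ i) (sym off≡))))
             (tileAt-shift (row (suc j)) (off (suc (suc j))) i))
    covered : ∀ i → i < w′ → f (suc i) ≡ true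
    covered i i<w′ = topOK-covered j (o + suc i) (tile j (suc i)) _
      (trans (above i) (nth-just T₁ (row (suc j)) (subst (i <_) (sym |next|) i<w′)))
    first : f 0 ≡ (tops (row j) ‼ 0 == a)
    first = trans (topOK-inner (o + 0) (tile j 0) sj<R
        (trans (sq-row (o + 0) sj<R) (tileAt-before (row (suc j)) (subst (o + 0 <_) (sym off≡) (s≤s (≤-reflexive (+-identityʳ o)))))))
      (cong (_== a) (sym (map-‼ topE (row j) (subst (0 <_) (sym |row|) z<s))))
    last : f (suc w′) ≡ (tops (row j) ‼ suc w′ == a)
    last = trans (topOK-inner (o + suc w′) (tile j (suc w′)) sj<R (trans (above w′) (nth-nothing (row (suc j)) (≤-reflexive |next|))))
      (cong (_== a) (sym (map-‼ topE (row j) (subst (suc w′ <_) (sym |row|) ≤-refl))))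

  topCheck-last : ∀ {j} → suc j ≡ R →
    topCheck j ≡ allBelow (wid (suc j)) (λ i → topE (tile j i) == layerLabel (leftToRight wt) n (off (suc j) + i))
  topCheck-last {j} sj≡R = allBelow-cong (wid (suc j)) (λ i _ → topOK-last (off (suc j) + i) (tile j i) sj≡R)

  topCheck-last-narrow : ∀ {j} → suc j ≡ R → lev (suc j) ≡ 1 → topCheck j ≡ (tops (row j) ==ᴸ wrap (leftToRight wt))
  topCheck-last-narrow {j} sj≡R one = trans (topCheck-last sj≡R)
    (allBelow-== topE (row j) _ (wrap (leftToRight wt)) (wid (suc j)) (row-length j<R) |wrap| pointwise)
    where
    j<R : j < R
    j<R = subst (j <_) sj≡R ≤-refl
    n≡ : n ≡ suc (off (suc j))
    n≡ = trans (∸-pred (subst (_≤ n) one (level-≤ (suc j)))) (cong (λ l → suc (n ∸ l)) (sym one))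
    |wrap| : length (wrap (leftToRight wt)) ≡ wid (suc j)
    |wrap| = trans (length-wrap (leftToRight wt))
      (sym (trans (cong (λ l → p + 2 * l) one) (trans (p+2[1+l]≡2+p+2l p 0) (cong (λ m → suc (suc m)) (trans (+-identityʳ p) (sym (length-leftToRight wt))))))) 
    pointwise : ∀ i → i < wid (suc j) → layerLabel (leftToRight wt) n (off (suc j) + i) ≡ wrap (leftToRight wt) ‼ i
    pointwise i _ = trans (cong (λ o → layerLabel (leftToRight wt) o (off (suc j) + i)) n≡) (layerLabel-wrap (leftToRight wt) (off (suc j)) i)

  topCheck-last-flat : ∀ {j} → suc j ≡ R → lev (suc j) ≡ 0 → topCheck j ≡ (tops (row j) ==ᴸ leftToRight wt)
  topCheck-last-flat {j} sj≡R zero′ = trans (topCheck-last sj≡R)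
    (allBelow-== topE (row j) _ (leftToRight wt) (wid (suc j)) (row-length j<R)
      (trans (length-leftToRight wt) (sym (trans (cong (λ l → p + 2 * l) zero′) (+-identityʳ p)))) pointwise)
    where
    j<R : j < R
    j<R = subst (j <_) sj≡R ≤-refl
    pointwise : ∀ i → i < wid (suc j) → layerLabel (leftToRight wt) n (off (suc j) + i) ≡ leftToRight wt ‼ i
    pointwise i _ = trans (cong (λ l → layerLabel (leftToRight wt) n (n ∸ l + i)) zero′) (layerLabel-shift (leftToRight wt) n i)

  lastPart : ℕ → Bool
  lastPart j = if suc j ≡ᵇ R then entering (suc j) ==ᴸ leftToRight wt else true

  lastPart-inner : ∀ {j} → suc j < R → lastPart j ≡ true
  lastPart-inner sj<R rewrite ≡ᵇ-false (<⇒≢ sj<R) = refl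

  lastPart-last : ∀ {j} → suc j ≡ R → lastPart j ≡ (entering (suc j) ==ᴸ leftToRight wt)
  lastPart-last sj≡R rewrite ≡ᵇ-true sj≡R = refl

  topCheck≡exit-covered : ∀ {j} → suc j < R → j < n + q → topCheck j ≡ exitOK (kind j) (row j) ∧ lastPart j
  topCheck≡exit-covered {j} sj<R j<n+q =
    trans (topCheck-covered sj<R (level-nondecreasing j<n+q)) (sym (cong₂ _∧_ exit-trivial (lastPart-inner sj<R)))
    where
    exit-trivial : exitOK (kind j) (row j) ≡ true
    exit-trivial with j <? n
    ... | yes j<n rewrite kind-lower j<n = refl
    ... | no j≮n rewrite kind-middle (≮⇒≥ j≮n) j<n+q = refl

  topCheck≡exit-ends : ∀ {j} → suc j < R → n + q ≤ j → topCheck j ≡ exitOK (kind j) (row j) ∧ lastPart j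
  topCheck≡exit-ends {j} sj<R n+q≤j = begin
    topCheck j                           ≡⟨ topCheck-ends sj<R (level-narrow (s≤s n+q≤j) (<⇒≤ sj<R)) ⟩
    endsA (tops (row j))                 ≡⟨ sym (∧-identityʳ _) ⟩
    endsA (tops (row j)) ∧ true          ≡⟨ cong₂ _∧_ (cong (λ k → exitOK k (row j)) (sym kind≡)) (sym (lastPart-inner sj<R)) ⟩
    exitOK (kind j) (row j) ∧ lastPart j ∎
    where
    open ≡-Reasoning
    kind≡ : kind j ≡ narrowing
    kind≡ = kind-upper n+q≤j (<-trans (n<1+n j) sj<R)

  last-flat⇒n≡0 : ∀ {j} → suc j ≡ R → suc j ≤ n + q → n ≡ 0
  last-flat⇒n≡0 {j} sj≡R sj≤n+q = n≤0⇒n≡0 (+-cancelʳ-≤ (n + q) n 0 (begin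
    n + (n + q)   ≡⟨ sym (+-assoc n n q) ⟩
    n + n + q     ≡⟨ cong (λ m → n + m + q) (sym (+-identityʳ n)) ⟩
    2 * n + q     ≡⟨ sym sj≡R ⟩
    suc j         ≤⟨ sj≤n+q ⟩
    n + q         ∎))
    where open ≤-Reasoning

  topCheck≡exit-last-flat : ∀ {j} → suc j ≡ R → suc j ≤ n + q → topCheck j ≡ exitOK (kind j) (row j) ∧ lastPart j
  topCheck≡exit-last-flat {j} sj≡R sj≤n+q = begin
    topCheck j                                        ≡⟨ topCheck-last-flat sj≡R (trans (level-middle n≤sj sj≤n+q) n≡0) ⟩
    tops (row j) ==ᴸ leftToRight wt                   ≡⟨ cong (λ k → exit k (row j) ==ᴸ leftToRight wt) (sym kind≡) ⟩
    entering (suc j) ==ᴸ leftToRight wt               ≡⟨ sym (lastPart-last sj≡R) ⟩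
    lastPart j                                        ≡⟨ cong (λ k → exitOK k (row j) ∧ lastPart j) (sym kind≡) ⟩
    exitOK (kind j) (row j) ∧ lastPart j              ∎
    where
    open ≡-Reasoning
    n≡0 : n ≡ 0
    n≡0 = last-flat⇒n≡0 sj≡R sj≤n+q
    n≤sj : n ≤ suc j
    n≤sj = subst (_≤ suc j) (sym n≡0) z≤n
    kind≡ : kind j ≡ keeping
    kind≡ = kind-middle (subst (_≤ j) (sym n≡0) z≤n) sj≤n+q

  topCheck≡exit-last-narrow : ∀ {j} → suc j ≡ R → n + q < suc j → topCheck j ≡ exitOK (kind j) (row j) ∧ lastPart j
  topCheck≡exit-last-narrow {j} sj≡R n+q<sj = begin
    topCheck j
      ≡⟨ topCheck-last-narrow sj≡R lev≡1 ⟩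
    tops (row j) ==ᴸ wrap (leftToRight wt)
      ≡⟨ ==ᴸ-wrap (tops (row j)) (leftToRight wt) 2≤|tops| ⟩
    endsA (tops (row j)) ∧ (inner (tops (row j)) ==ᴸ leftToRight wt)
      ≡⟨ cong (λ k → exitOK k (row j) ∧ (exit k (row j) ==ᴸ leftToRight wt)) (sym kind≡) ⟩
    exitOK (kind j) (row j) ∧ (entering (suc j) ==ᴸ leftToRight wt)
      ≡⟨ cong (exitOK (kind j) (row j) ∧_) (sym (lastPart-last sj≡R)) ⟩
    exitOK (kind j) (row j) ∧ lastPart j ∎
    where
    open ≡-Reasoning
    j<R : j < R
    j<R = subst (j <_) sj≡R ≤-refl
    kind≡ : kind j ≡ narrowing
    kind≡ = kind-upper (≤-pred n+q<sj) j<R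
    lev≡1 : lev (suc j) ≡ 1
    lev≡1 = trans (level-upper n+q<sj) (trans (cong (suc (2 * n + q) ∸_) sj≡R) (m+n∸n≡m 1 (2 * n + q)))
    2≤|tops| : 2 ≤ length (tops (row j))
    2≤|tops| = subst (2 ≤_) (sym (trans (List.length-map topE (row j)) (trans (row-length j<R) (cong (λ l → p + 2 * l) lev≡1))))
      (m≤n+m 2 p)

  topCheck≡exit : ∀ {j} → j < R → topCheck j ≡ exitOK (kind j) (row j) ∧ lastPart j
  topCheck≡exit {j} j<R with suc j <? R | j <? n + q
  ... | yes sj<R | yes j<n+q = topCheck≡exit-covered sj<R j<n+q
  ... | yes sj<R | no j≮n+q = topCheck≡exit-ends sj<R (≮⇒≥ j≮n+q)
  ... | no sj≮R | yes j<n+q = topCheck≡exit-last-flat (≤-antisym j<R (≮⇒≥ sj≮R)) j<n+q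
  ... | no sj≮R | no j≮n+q = topCheck≡exit-last-narrow (≤-antisym j<R (≮⇒≥ sj≮R)) (s≤s (≮⇒≥ j≮n+q))

  row≡rowSpec : ∀ {j} → j < R → allBelow W (vOK wb wt (suc j)) ≡ rowSpec (adKinds q n) (leftToRight wb) (leftToRight wt) rs j
  row≡rowSpec {j} j<R = begin
    allBelow W (vOK wb wt (suc j))
      ≡⟨ row-split j<R ⟩
    bottomCheck j ∧ topCheck j
      ≡⟨ cong₂ _∧_ (bottomCheck≡entry j<R) (topCheck≡exit j<R) ⟩
    (bottoms (row j) ==ᴸ entry (kind j) (entering j)) ∧ (exitOK (kind j) (row j) ∧ lastPart j)
      ≡⟨ sym (∧-assoc (bottoms (row j) ==ᴸ entry (kind j) (entering j)) _ _) ⟩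
    rowCond (kind j) (entering j) (row j) ∧ lastPart j
      ≡⟨ cong (λ k → rowCond (kind j) (entering j) (row j) ∧ (if suc j ≡ᵇ k then entering (suc j) ==ᴸ leftToRight wt else true))
              (sym (length-adKinds q n)) ⟩
    rowSpec (adKinds q n) (leftToRight wb) (leftToRight wt) rs j ∎
    where open ≡-Reasoning

  good≡acceptsL : 0 < R → good wb wt ≡ acceptsL (adKinds q n) (leftToRight wb) (leftToRight wt) rs
  good≡acceptsL 0<R = begin
    allB (rowOKL a a) rs ∧ allB (λ j → allB (λ c → vOK wb wt (suc j) c) (upTo W)) (upTo R)
      ≡⟨ cong (allB (rowOKL a a) rs ∧_) (trans (allB-applyUpTo _ (λ j → j) R)
           (allBelow-cong R (λ j j<R → trans (allB-applyUpTo (vOK wb wt (suc j)) (λ c → c) W) (row≡rowSpec j<R)))) ⟩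
    allB (rowOKL a a) rs ∧ allBelow R (rowSpec (adKinds q n) (leftToRight wb) (leftToRight wt) rs)
      ≡⟨ cong (λ k → allB (rowOKL a a) rs ∧ allBelow k (rowSpec (adKinds q n) (leftToRight wb) (leftToRight wt) rs))
              (sym (length-adKinds q n)) ⟩
    allB (rowOKL a a) rs ∧ allBelow (length (adKinds q n)) (rowSpec (adKinds q n) (leftToRight wb) (leftToRight wt) rs)
      ≡⟨ sym (acceptsL-unroll (adKinds q n) (leftToRight wb) (leftToRight wt) rs
               (trans rows-length (sym (length-adKinds q n))) (subst (0 <_) (sym (length-adKinds q n)) 0<R)) ⟩
    acceptsL (adKinds q n) (leftToRight wb) (leftToRight wt) rs ∎
    where open ≡-Reasoning

countN≡transfer : ∀ p q n → 0 < 2 * n + q → countN p q n ≈ᴹ transfer (adPath p q n)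
countN≡transfer p q n 0<R wb wt = begin
  count (λ M → good′ (rowsOf M)) (allMosaics (rowLens p q n))
    ≡⟨ cong (λ ls → count (λ (M : Mosaic ls) → good′ (rowsOf M)) (allMosaics ls)) (rowLens≡rowWidths p q n) ⟩
  count (λ M → good′ (rowsOf M)) (allMosaics (rowWidths s))
    ≡⟨ count-cong (allMosaics (rowWidths s)) good≡accepts ⟩
  count (accepts s wb wt) (allMosaics (rowWidths s))
    ≡⟨ count-accepts s wb wt ⟩
  transfer s wb wt ∎
  where
  open ≡-Reasoning
  s = adPath p q n
  good′ : List (List Tile) → Bool
  good′ rs = Region.good p q n rs wb wt
  good≡accepts : ∀ M → good′ (rowsOf M) ≡ accepts s wb wt M
  good≡accepts M = trans (RowChecks.good≡acceptsL p q n (rowsOf M) wb wt rows-length row-length 0<R)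
    (sym (trans (accepts≡acceptsL s wb wt M) (cong (λ ks → acceptsL ks _ _ (rowsOf M)) (kinds-adPath p q n))))
    where
    lengths : map length (rowsOf M) ≡ applyUpTo (λ i → rowLen p q n (suc i)) (2 * n + q)
    lengths = trans (map-length-rowsOf (rowWidths s) M) (sym (rowLens≡rowWidths p q n))
    rows-length : length (rowsOf M) ≡ 2 * n + q
    rows-length = trans (sym (List.length-map length (rowsOf M))) (trans (cong length lengths) (List.length-applyUpTo _ _))
    row-length : ∀ {j} → j < 2 * n + q → length (nthOr [] (rowsOf M) j) ≡ p + 2 * level q n (suc j)
    row-length {j} j<R = trans (sym (nthOr-map length [] (rowsOf M) j))
      (trans (cong (λ xs → nthOr 0 xs j) lengths) (trans (nthOr-applyUpTo 0 _ j<R) (rowLen-level p q n (suc j))))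

N≈transfer : ∀ p q n → N p q n ≈ᴹ transfer (adPath p q n)
N≈transfer p zero zero = ≈ᴹ-refl
N≈transfer p (suc q) zero = countN≡transfer p (suc q) zero z<s
N≈transfer p q (suc n) = countN≡transfer p q (suc n) z<s

lemma4 : (p q n : ℕ) (i j : Word p) →
    N p q n i j ≡ ((Lprod p n ⊗ (C (dim p n) ^ᴹ q)) ⊗ Uprod p n) i j
lemma4 p q n = ≈ᴹ-trans (N≈transfer p q n) (transfer-adPath p q n)
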